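{- For every integer $n\geq 2$, $$a_n(4321;213)=a_n(4321;312)=F_{2n-3},$$ where $F_m$ is the $m$-th Fibonacci number.
   Context: A permutation $\pi$ of $[n]=\{1,\dots,n\}$ is cyclic if it consists of a single $n$-cycle. Its one-line notation is $\pi_1\pi_2\cdots\pi_n$ with $\pi_i=\pi(i)$. Its standard cycle form is $(c_1,c_2,\dots,c_n)$ with $c_1=1$ and $c_{i+1}=\pi(c_i)$ for $1\le i<n$. A sequence $w_1\cdots w_n$ of distinct integers contains a pattern $\sigma=\sigma_1\cdots\sigma_k\in S_k$ if there are indices $i_1<\dots<i_k$ with $w_{i_s}>w_{i_t}$ iff $\sigma_s>\sigma_t$ for all $s<t$; otherwise it avoids $\sigma$. $\mathcal{A}_n(\sigma;\rho)$ is the set of cyclic permutations of $[n]$ whose one-line notation avoids $\sigma$ and whose standard cycle form $c_1\cdots c_n$, read as a sequence, avoids $\rho$; $a_n(\sigma;\rho)$ is its cardinality. Fibonacci numbers: $F_0=0$, $F_1=1$, $F_m=F_{m-1}+F_{m-2}$. -}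

module Defs where

open import Data.Nat using (ℕ; zero; suc; _+_; _>_)
open import Data.Fin as Fin using (Fin; toℕ; cast)
open import Data.Vec using (Vec; lookup)
open import Data.List using (List; []; _∷_; length; map; upTo)
import Data.List as L
open import Data.List.Relation.Binary.Sublist.Propositional using (_⊆_)
open import Data.List.Relation.Unary.Unique.Propositional using (Unique)
open import Data.List.Membership.Propositional using (_∈_)
open import Data.Product using (Σ; ∃; _×_)
open import Relation.Nullary using (¬_)
open import Function.Bundles using (_⇔_)
open import Relation.Binary.PropositionalEquality using (_≡_)

F : ℕ → ℕ
F zero = 0
F (suc zero) = 1
F (suc (suc m)) = F (suc m) + F m

-- A map [n] → [n] in one-line notation; entry i is π(i+1) - 1 (0-based Fin).
OneLine : ℕ → Set
OneLine n = Vec (Fin n) n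

IsPerm : ∀ {n} → OneLine n → Set
IsPerm {n} π = ∀ (i j : Fin n) → lookup π i ≡ lookup π j → i ≡ j

iter : ∀ {n} → OneLine n → ℕ → Fin n → Fin n
iter π zero x = x
iter π (suc k) x = lookup π (iter π k x)

IsCyclic : ∀ {n} → OneLine n → Set
IsCyclic {n} π = IsPerm π × (∀ (x y : Fin n) → ∃ λ k → iter π k x ≡ y)

oneLineSeq : ∀ {n} → OneLine n → List ℕ
oneLineSeq {n} π = map (λ i → suc (toℕ (lookup π i))) (L.allFin n)

-- standard cycle form c_1 … c_n with c_1 = 1, c_{i+1} = π(c_i) (1-based values)
cycleForm : ∀ {n} → OneLine n → List ℕ
cycleForm {zero} π = []
cycleForm {suc n} π = map (λ k → suc (toℕ (iter π k Fin.zero))) (upTo (suc n))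

OrderIso : List ℕ → List ℕ → Set
OrderIso u σ = Σ (length u ≡ length σ) λ eq →
  ∀ (s t : Fin (length u)) → s Fin.< t →
    (L.lookup u s > L.lookup u t) ⇔ (L.lookup σ (cast eq s) > L.lookup σ (cast eq t))

Contains : List ℕ → List ℕ → Set
Contains w σ = ∃ λ (u : List ℕ) → (u ⊆ w) × OrderIso u σ

Avoids : List ℕ → List ℕ → Set
Avoids w σ = ¬ Contains w σ

InA : (n : ℕ) → List ℕ → List ℕ → OneLine n → Set
InA n σ ρ π = IsCyclic π × Avoids (oneLineSeq π) σ × Avoids (cycleForm π) ρ

HasCount : ∀ {n} → (OneLine n → Set) → ℕ → Set
HasCount {n} P k = ∃ λ (ℓ : List (OneLine n)) →
  Unique ℓ × length ℓ ≡ k × (∀ π → (π ∈ ℓ) ⇔ P π)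

aEq : ℕ → List ℕ → List ℕ → ℕ → Set
aEq n σ ρ k = HasCount (InA n σ ρ) k

p4321 p213 p312 : List ℕ
p4321 = 4 ∷ 3 ∷ 2 ∷ 1 ∷ []
p213 = 2 ∷ 1 ∷ 3 ∷ []
p312 = 3 ∷ 1 ∷ 2 ∷ []

-- A cyclic permutation π of [n] is determined by the tail t of its standard cycle form 1 t, a word
-- using each of 2, …, n once: π sends each letter of 1 t to the next one and the last one back to 1.
-- The pairs (x , π x) are the arcs of t, and the one-line notation of π contains 4321 exactly when
-- four arcs have increasing sources and decreasing targets.  The leading 1 takes part in no 213, so
-- a_n(4321;213) counts the admissible tails: those avoiding 213 with no such chain of arcs.
--
-- Deleting 2 from an admissible tail and lowering the larger letters gives an admissible tail one
-- size smaller, its parent.  Conversely, the admissible tails with parent p are obtained by raising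
-- the letters of p and inserting 2 at the front, at the end, or just before 3, the last only when p
-- does not start with 2: in a tail, 2 followed by some b ≠ 3 gives the 213 occurrence 3 2 b or,
-- when 3 comes later, a chain of arcs.
-- So the number g of admissible tails and the number h of those not starting with 2 satisfy
-- g′ = 2g + h and h′ = g + h, from g = 1 and h = 0 at n = 2; hence g = F(2n − 3).
-- Reversing tails exchanges 213 and 312 and maps chains to chains, which gives the second count.

module Submission where

open import Defs
open import Data.Nat using (ℕ; zero; suc; pred; _+_; _*_; _∸_; _≤_; _<_; _>_; z≤n; s≤s; _≟_; >-nonZero)
open import Data.Nat.Properties
open import Data.Nat.DivMod using (_mod_; _%_; _/_; m%n<n; m<n⇒m%n≡m; m≡m%n+[m/n]*n)
open import Data.Fin as Fin using (Fin; toℕ; cast)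
open import Data.Fin.Patterns using (0F; 1F; 2F; 3F)
open import Data.Fin.Properties using (toℕ-injective; toℕ<n; toℕ-fromℕ<; pigeonhole)
import Data.Vec as Vec
open import Data.Vec.Properties using (lookup∘tabulate; tabulate-cong; tabulate∘lookup)
open import Data.List using (List; []; _∷_; _++_; map; length; reverse; filter; applyUpTo)
import Data.List as List
open import Data.List.Properties
  using ( ++-assoc; ++-identityʳ; map-++; map-∘; map-cong; map-cong-local; map-id; map-upTo; map-tabulate
        ; length-++; length-map; length-reverse; length-applyUpTo; applyUpTo-∷ʳ
        ; unfold-reverse; reverse-++; reverse-involutive; reverse-injective
        ; filter-all; filter-none; filter-accept; filter-++ )
open import Data.List.Relation.Binary.Sublist.Propositional
  using (_⊆_; []; _∷_; _∷ʳ_; ⊆-refl; ⊆-trans; from∈; minimum; lookup)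
open import Data.List.Relation.Binary.Sublist.Propositional.Properties
  using (∷ˡ⁻; ++⁺; ++⁺ʳ; map⁺; reverse⁺; length-mono-≤; All-resp-⊆)
open import Data.List.Relation.Unary.All using (All; []; _∷_)
import Data.List.Relation.Unary.All as All
import Data.List.Relation.Unary.All.Properties as AllP
open import Data.List.Relation.Unary.Any using (here; there)
import Data.List.Relation.Unary.Any.Properties as AnyP
open import Data.List.Relation.Unary.AllPairs using ([]; _∷_)
open import Data.List.Relation.Unary.Unique.Propositional using (Unique)
import Data.List.Relation.Unary.Unique.Propositional.Properties as Unique
open import Data.List.Membership.Propositional using (_∈_; _∉_)
open import Data.List.Membership.Propositional.Properties
  using ( ∈-++⁺ˡ; ∈-++⁺ʳ; ∈-++⁻; ∈-map⁺; ∈-map⁻; ∈-insert; ∈-∃++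
        ; ∈-filter⁺; ∈-filter⁻; ∈-applyUpTo⁺; ∈-applyUpTo⁻ )
open import Data.Product using (∃; ∃₂; _×_; _,_; proj₁; proj₂)
import Data.Product as Product
open import Data.Sum using (_⊎_; inj₁; inj₂)
import Data.Sum as Sum
open import Data.Empty using (⊥; ⊥-elim)
open import Data.Unit using (⊤; tt)
open import Function using (case_of_; _∘_)
open import Function.Bundles using (_⇔_; mk⇔; Equivalence)
open import Relation.Nullary using (¬_; Dec; yes; no; ¬?)
open import Relation.Unary using (U; ∁; Decidable)
open import Relation.Binary using (tri<; tri≈; tri>)
open import Relation.Binary.PropositionalEquality
  using (_≡_; refl; sym; trans; cong; cong₂; subst; subst₂; _≢_; module ≡-Reasoning)

module _ {A : Set} where

  Unique-resp-⊆ : ∀ {xs ys : List A} → xs ⊆ ys → Unique ys → Unique xs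
  Unique-resp-⊆ [] u = u
  Unique-resp-⊆ (_ ∷ʳ p) (_ ∷ u) = Unique-resp-⊆ p u
  Unique-resp-⊆ (refl ∷ p) (x∉ ∷ u) = All-resp-⊆ p x∉ ∷ Unique-resp-⊆ p u

  ∷⊆⇒∈ : ∀ {x : A} {xs ys} → x ∷ xs ⊆ ys → x ∈ ys
  ∷⊆⇒∈ p = lookup p (here refl)

  Unique-middle : ∀ xs {x : A} ys → Unique (xs ++ x ∷ ys) → x ∉ xs × x ∉ ys
  Unique-middle [] ys u = (λ ()) , Unique.Unique[x∷xs]⇒x∉xs u
  Unique-middle (y ∷ xs) ys (y∉ ∷ u) =
    (λ { (here refl) → All.lookup y∉ (∈-++⁺ʳ xs (here refl)) refl ; (there m) → proj₁ (Unique-middle xs ys u) m })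
    , proj₂ (Unique-middle xs ys u)

  ⊆-remove : ∀ xs {x : A} ys {u} → All (_≢ x) u → u ⊆ xs ++ x ∷ ys → u ⊆ xs ++ ys
  ⊆-remove []       ys _          (_ ∷ʳ p)    = p
  ⊆-remove []       ys (x≢x ∷ _)  (refl ∷ p)  = ⊥-elim (x≢x refl)
  ⊆-remove (y ∷ xs) ys ne         (.y ∷ʳ p)   = y ∷ʳ ⊆-remove xs ys ne p
  ⊆-remove (y ∷ xs) ys (_ ∷ ne)   (refl ∷ p)  = refl ∷ ⊆-remove xs ys ne p

  ⊆-after : ∀ xs {x : A} ys {r} → x ∉ xs → x ∷ r ⊆ xs ++ x ∷ ys → r ⊆ ys
  ⊆-after []       ys _   (_ ∷ʳ p)   = ∷ˡ⁻ p
  ⊆-after []       ys _   (refl ∷ p) = p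
  ⊆-after (y ∷ xs) ys x∉  (.y ∷ʳ p)  = ⊆-after xs ys (λ m → x∉ (there m)) p
  ⊆-after (y ∷ xs) ys x∉  (refl ∷ p) = ⊥-elim (x∉ (here refl))

  ⊆-around : ∀ xs {x : A} ys {a r} → x ∉ xs → x ∉ ys → a ∷ x ∷ r ⊆ xs ++ x ∷ ys → a ∈ xs × r ⊆ ys
  ⊆-around []       ys _   x∉ys (_ ∷ʳ p)   = ⊥-elim (x∉ys (∷⊆⇒∈ (∷ˡ⁻ p)))
  ⊆-around []       ys _   x∉ys (refl ∷ p) = ⊥-elim (x∉ys (∷⊆⇒∈ p))
  ⊆-around (y ∷ xs) ys x∉  x∉ys (.y ∷ʳ p)  =
    let a∈ , r⊆ = ⊆-around xs ys (λ m → x∉ (there m)) x∉ys p in there a∈ , r⊆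
  ⊆-around (y ∷ xs) ys x∉  _    (refl ∷ p) = here refl , ⊆-after xs ys (λ m → x∉ (there m)) p

  ∈-insert⁻ : ∀ xs {x y : A} ys → y ∈ xs ++ x ∷ ys → y ≡ x ⊎ y ∈ xs ++ ys
  ∈-insert⁻ []       ys (here refl) = inj₁ refl
  ∈-insert⁻ []       ys (there m)   = inj₂ m
  ∈-insert⁻ (z ∷ xs) ys (here refl) = inj₂ (here refl)
  ∈-insert⁻ (z ∷ xs) ys (there m)   = Sum.map₂ there (∈-insert⁻ xs ys m)

  ∈-insert⁺ : ∀ xs {x y : A} ys → y ∈ xs ++ ys → y ∈ xs ++ x ∷ ys
  ∈-insert⁺ xs {x} ys = lookup (++⁺ (⊆-refl {x = xs}) (x ∷ʳ ⊆-refl))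

  Unique-insert : ∀ xs {x : A} ys → x ∉ xs ++ ys → Unique (xs ++ ys) → Unique (xs ++ x ∷ ys)
  Unique-insert []       ys x∉ u        = AllP.¬Any⇒All¬ ys x∉ ∷ u
  Unique-insert (z ∷ xs) ys x∉ (z∉ ∷ u) = All.tabulate z≢ ∷ Unique-insert xs ys (x∉ ∘ there) u
    where
    z≢ : ∀ {y} → y ∈ xs ++ _ ∷ ys → z ≢ y
    z≢ m with ∈-insert⁻ xs ys m
    ... | inj₁ refl = λ z≡x → x∉ (here (sym z≡x))
    ... | inj₂ m′   = All.lookup z∉ m′

  Unique-remove : ∀ xs {x : A} ys → Unique (xs ++ x ∷ ys) → Unique (xs ++ ys)
  Unique-remove xs {x} ys = Unique-resp-⊆ (++⁺ (⊆-refl {x = xs}) (x ∷ʳ ⊆-refl))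

  applyUpTo-cong : ∀ {f g : ℕ → A} n → (∀ {k} → k < n → f k ≡ g k) → applyUpTo f n ≡ applyUpTo g n
  applyUpTo-cong zero    _   = refl
  applyUpTo-cong (suc n) f≗g = cong₂ _∷_ (f≗g (s≤s z≤n)) (applyUpTo-cong n (f≗g ∘ s≤s))

  Unique-reverse : ∀ {xs : List A} → Unique xs → Unique (reverse xs)
  Unique-reverse {[]}     u        = u
  Unique-reverse {x ∷ xs} (x∉ ∷ u) = subst Unique (sym (unfold-reverse x xs))
    (Unique.++⁺ (Unique-reverse u) ([] ∷ []) λ { (x∈ , here refl) → All.lookup x∉ (AnyP.reverse⁻ x∈) refl })

module _ {A B : Set} (f : A → B) where

  ⊆-map⁻ : ∀ {u} (w : List A) → u ⊆ map f w → ∃ λ v → v ⊆ w × u ≡ map f v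
  ⊆-map⁻ []      []       = [] , [] , refl
  ⊆-map⁻ (x ∷ w) (_ ∷ʳ p) = let v , q , e = ⊆-map⁻ w p in v , x ∷ʳ q , e
  ⊆-map⁻ (x ∷ w) (refl ∷ p) = let v , q , e = ⊆-map⁻ w p in x ∷ v , refl ∷ q , cong (f x ∷_) e

module _ {A : Set} where

  adjacent : List A → List (A × A)
  adjacent (x ∷ y ∷ r) = (x , y) ∷ adjacent (y ∷ r)
  adjacent _           = []

  lastOf : A → List A → A
  lastOf a []      = a
  lastOf a (b ∷ w) = lastOf b w

  lastOf∈ : ∀ a w → lastOf a w ∈ a ∷ w
  lastOf∈ a []      = here refl
  lastOf∈ a (b ∷ w) = there (lastOf∈ b w)

  lastOf-++ : ∀ a w x r → lastOf a (w ++ x ∷ r) ≡ lastOf x r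
  lastOf-++ a []      x r = refl
  lastOf-++ a (b ∷ w) x r = lastOf-++ b w x r

  adjacent-++ : ∀ a w x r → adjacent (a ∷ w ++ x ∷ r) ≡ adjacent (a ∷ w) ++ (lastOf a w , x) ∷ adjacent (x ∷ r)
  adjacent-++ a []      x r = refl
  adjacent-++ a (b ∷ w) x r = cong ((a , b) ∷_) (adjacent-++ b w x r)

  ∈-adjacent-last : ∀ a w x r → (lastOf a w , x) ∈ adjacent (a ∷ w ++ x ∷ r)
  ∈-adjacent-last a w x r = subst (_ ∈_) (sym (adjacent-++ a w x r)) (∈-++⁺ʳ _ (here refl))

  ∈-adjacent-right : ∀ a w x r {q} → q ∈ adjacent (x ∷ r) → q ∈ adjacent (a ∷ w ++ x ∷ r)
  ∈-adjacent-right a w x r m = subst (_ ∈_) (sym (adjacent-++ a w x r)) (∈-++⁺ʳ _ (there m))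

  adjacent-target∈ : ∀ a w {x y} → (x , y) ∈ adjacent (a ∷ w) → y ∈ w
  adjacent-target∈ a (b ∷ w) (here refl) = here refl
  adjacent-target∈ a (b ∷ w) (there m)   = there (adjacent-target∈ b w m)

  adjacent-source∈ : ∀ a w e {x y} → (x , y) ∈ adjacent (a ∷ w ++ e ∷ []) → x ∈ a ∷ w
  adjacent-source∈ a []      e (here refl) = here refl
  adjacent-source∈ a (b ∷ w) e (here refl) = here refl
  adjacent-source∈ a (b ∷ w) e (there m)   = there (adjacent-source∈ b w e m)

  adjacent-functional : ∀ w {e x y y′} → Unique w →
    (x , y) ∈ adjacent (w ++ e ∷ []) → (x , y′) ∈ adjacent (w ++ e ∷ []) → y ≡ y′
  adjacent-functional (a ∷ [])    _          (here refl) (here refl) = refl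
  adjacent-functional (a ∷ b ∷ w) _          (here refl) (here refl) = refl
  adjacent-functional (a ∷ b ∷ w) (a∉ ∷ _)   (here refl) (there m)   = ⊥-elim (All.lookup a∉ (adjacent-source∈ b w _ m) refl)
  adjacent-functional (a ∷ b ∷ w) (a∉ ∷ _)   (there m)   (here refl) = ⊥-elim (All.lookup a∉ (adjacent-source∈ b w _ m) refl)
  adjacent-functional (a ∷ b ∷ w) (_ ∷ u)    (there m)   (there m′)  = adjacent-functional (b ∷ w) u m m′

  adjacent-injective : ∀ a w {x x′ y} → Unique w →
    (x , y) ∈ adjacent (a ∷ w) → (x′ , y) ∈ adjacent (a ∷ w) → x ≡ x′
  adjacent-injective a (b ∷ w) _        (here refl) (here refl) = refl
  adjacent-injective a (b ∷ w) (b∉ ∷ _) (here refl) (there m)   = ⊥-elim (All.lookup b∉ (adjacent-target∈ b w m) refl)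
  adjacent-injective a (b ∷ w) (b∉ ∷ _) (there m)   (here refl) = ⊥-elim (All.lookup b∉ (adjacent-target∈ b w m) refl)
  adjacent-injective a (b ∷ w) (_ ∷ u)  (there m)   (there m′)  = adjacent-injective b w u m m′

  ∈-adjacent⁻ : ∀ {x y} w → (x , y) ∈ adjacent w → ∃₂ λ α β → w ≡ α ++ x ∷ y ∷ β
  ∈-adjacent⁻ (a ∷ b ∷ w) (here refl) = [] , w , refl
  ∈-adjacent⁻ (a ∷ b ∷ w) (there m)   = let α , β , e = ∈-adjacent⁻ (b ∷ w) m in a ∷ α , β , cong (a ∷_) e

  ∈-adjacent⁺ : ∀ {x y} α β → (x , y) ∈ adjacent (α ++ x ∷ y ∷ β)
  ∈-adjacent⁺ []          β = here refl
  ∈-adjacent⁺ (a ∷ [])    β = there (here refl)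
  ∈-adjacent⁺ (a ∷ b ∷ α) β = there (∈-adjacent⁺ (b ∷ α) β)

  adjacent-reverse : ∀ {x y} w → (x , y) ∈ adjacent w → (y , x) ∈ adjacent (reverse w)
  adjacent-reverse {x} {y} w m with ∈-adjacent⁻ w m
  ... | α , β , refl = subst (λ v → (y , x) ∈ adjacent v) (sym reverse-split) (∈-adjacent⁺ (reverse β) (reverse α))
    where
    reverse-split : reverse (α ++ x ∷ y ∷ β) ≡ reverse β ++ y ∷ x ∷ reverse α
    reverse-split = begin
      reverse (α ++ x ∷ y ∷ β)                   ≡⟨ reverse-++ α (x ∷ y ∷ β) ⟩
      reverse (x ∷ y ∷ β) ++ reverse α           ≡⟨ cong (_++ reverse α) (unfold-reverse x (y ∷ β)) ⟩
      (reverse (y ∷ β) ++ x ∷ []) ++ reverse α   ≡⟨ cong (λ v → (v ++ x ∷ []) ++ reverse α) (unfold-reverse y β) ⟩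
      ((reverse β ++ y ∷ []) ++ x ∷ []) ++ reverse α
        ≡⟨ ++-assoc (reverse β ++ y ∷ []) (x ∷ []) (reverse α) ⟩
      (reverse β ++ y ∷ []) ++ x ∷ reverse α     ≡⟨ ++-assoc (reverse β) (y ∷ []) (x ∷ reverse α) ⟩
      reverse β ++ y ∷ x ∷ reverse α             ∎
      where open ≡-Reasoning

adjacent-map : ∀ {A B : Set} (f : A → B) w → adjacent (map f w) ≡ map (Product.map f f) (adjacent w)
adjacent-map f []          = refl
adjacent-map f (x ∷ [])    = refl
adjacent-map f (x ∷ y ∷ w) = cong ((f x , f y) ∷_) (adjacent-map f (y ∷ w))

adjacent-applyUpTo : ∀ {A : Set} (f : ℕ → A) n {k} → k < n → (f k , f (suc k)) ∈ adjacent (applyUpTo f (suc n))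
adjacent-applyUpTo f (suc n) {zero}  _         = here refl
adjacent-applyUpTo f (suc n) {suc k} (s≤s k<n) = there (adjacent-applyUpTo (f ∘ suc) n k<n)

raise : ℕ → ℕ
raise 0               = 0
raise 1               = 1
raise (suc (suc k))   = suc (suc (suc k))

lower : ℕ → ℕ
lower 0             = 0
lower 1             = 1
lower (suc (suc k)) = suc k

lower-raise : ∀ x → lower (raise x) ≡ x
lower-raise 0             = refl
lower-raise 1             = refl
lower-raise (suc (suc x)) = refl

raise-lower : ∀ {x} → x ≢ 2 → raise (lower x) ≡ x
raise-lower {0}                 _   = refl
raise-lower {1}                 _   = refl
raise-lower {2}                 2≢2 = ⊥-elim (2≢2 refl)
raise-lower {suc (suc (suc x))} _   = refl

raise≢2 : ∀ x → raise x ≢ 2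
raise≢2 0             ()
raise≢2 1             ()
raise≢2 (suc (suc x)) ()

raise-≥2 : ∀ {x} → 2 ≤ x → raise x ≡ suc x
raise-≥2 (s≤s (s≤s _)) = refl

raise-injective : ∀ {x y} → raise x ≡ raise y → x ≡ y
raise-injective {x} {y} e = trans (sym (lower-raise x)) (trans (cong lower e) (lower-raise y))

raise-mono-< : ∀ {x y} → x < y → raise x < raise y
raise-mono-< {0}           {1}           _                 = s≤s z≤n
raise-mono-< {0}           {suc (suc y)} _                 = s≤s z≤n
raise-mono-< {1}           {suc (suc y)} _                 = s≤s (s≤s z≤n)
raise-mono-< {1}           {1}           (s≤s ())
raise-mono-< {suc (suc x)} {suc (suc y)} (s≤s (s≤s x<y))   = s≤s (s≤s (s≤s x<y))

raise-cancel-< : ∀ {x y} → raise x < raise y → x < y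
raise-cancel-< {x} {y} lt with <-cmp x y
... | tri< x<y _ _ = x<y
... | tri≈ _ refl _ = ⊥-elim (<-irrefl refl lt)
... | tri> _ _ y<x = ⊥-elim (<-asym lt (raise-mono-< y<x))

lower-mono-< : ∀ {x y} → x ≢ 2 → y ≢ 2 → x < y → lower x < lower y
lower-mono-< x≢2 y≢2 lt =
  raise-cancel-< (subst₂ _<_ (sym (raise-lower x≢2)) (sym (raise-lower y≢2)) lt)

-- Occurrences of 213, 312 and 4321

record Has213 (w : List ℕ) : Set where
  constructor has213
  field
    {a b c}    : ℕ
    occurrence : a ∷ b ∷ c ∷ [] ⊆ w
    b<a        : b < a
    a<c        : a < c

record Has312 (w : List ℕ) : Set where
  constructor has312
  field
    {a b c}    : ℕ
    occurrence : a ∷ b ∷ c ∷ [] ⊆ w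
    b<c        : b < c
    c<a        : c < a

record Has4321 (w : List ℕ) : Set where
  constructor has4321
  field
    {a b c d}  : ℕ
    occurrence : a ∷ b ∷ c ∷ d ∷ [] ⊆ w
    b<a        : b < a
    c<b        : c < b
    d<c        : d < c

contains⇒has213 : ∀ {w} → Unique w → Contains w p213 → Has213 w
contains⇒has213 u (_ ∷ _ ∷ _ ∷ [] , occ , refl , iso) with Unique-resp-⊆ occ u
... | (_ ∷ a≢c ∷ []) ∷ _ = has213 occ
  (Equivalence.from (iso 0F 1F (s≤s z≤n)) (s≤s (s≤s z≤n)))
  (≤∧≢⇒< (≮⇒≥ λ c<a → case Equivalence.to (iso 0F 2F (s≤s z≤n)) c<a of λ { (s≤s (s≤s ())) }) a≢c)

has213⇒contains : ∀ {w} → Has213 w → Contains w p213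
has213⇒contains (has213 {a} {b} {c} occ b<a a<c) = _ , occ , refl , iso
  where
  iso : ∀ s t → s Fin.< t →
    (List.lookup (a ∷ b ∷ c ∷ []) s > List.lookup (a ∷ b ∷ c ∷ []) t) ⇔
    (List.lookup p213 (cast refl s) > List.lookup p213 (cast refl t))
  iso 0F 1F _ = mk⇔ (λ _ → s≤s (s≤s z≤n)) (λ _ → b<a)
  iso 0F 2F _ = mk⇔ (λ c<a → ⊥-elim (<-asym c<a a<c)) λ { (s≤s (s≤s ())) }
  iso 1F 2F _ = mk⇔ (λ c<b → ⊥-elim (<-asym c<b (<-trans b<a a<c))) λ { (s≤s ()) }
  iso 0F 0F ()
  iso 1F 0F ()
  iso 1F 1F (s≤s ())
  iso 2F 0F ()
  iso 2F 1F (s≤s ())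
  iso 2F 2F (s≤s (s≤s ()))

contains⇒has312 : ∀ {w} → Unique w → Contains w p312 → Has312 w
contains⇒has312 u (_ ∷ _ ∷ _ ∷ [] , occ , refl , iso) with Unique-resp-⊆ occ u
... | _ ∷ (b≢c ∷ []) ∷ _ = has312 occ
  (≤∧≢⇒< (≮⇒≥ λ c<b → case Equivalence.to (iso 1F 2F (s≤s (s≤s z≤n))) c<b of λ { (s≤s ()) }) b≢c)
  (Equivalence.from (iso 0F 2F (s≤s z≤n)) (s≤s (s≤s (s≤s z≤n))))

has312⇒contains : ∀ {w} → Has312 w → Contains w p312
has312⇒contains (has312 {a} {b} {c} occ b<c c<a) = _ , occ , refl , iso
  where
  iso : ∀ s t → s Fin.< t →
    (List.lookup (a ∷ b ∷ c ∷ []) s > List.lookup (a ∷ b ∷ c ∷ []) t) ⇔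
    (List.lookup p312 (cast refl s) > List.lookup p312 (cast refl t))
  iso 0F 1F _ = mk⇔ (λ _ → s≤s (s≤s z≤n)) (λ _ → <-trans b<c c<a)
  iso 0F 2F _ = mk⇔ (λ _ → s≤s (s≤s (s≤s z≤n))) (λ _ → c<a)
  iso 1F 2F _ = mk⇔ (λ c<b → ⊥-elim (<-asym c<b b<c)) λ { (s≤s ()) }
  iso 0F 0F ()
  iso 1F 0F ()
  iso 1F 1F (s≤s ())
  iso 2F 0F ()
  iso 2F 1F (s≤s ())
  iso 2F 2F (s≤s (s≤s ()))

contains⇒has4321 : ∀ {w} → Contains w p4321 → Has4321 w
contains⇒has4321 (_ ∷ _ ∷ _ ∷ _ ∷ [] , occ , refl , iso) = has4321 occ
  (Equivalence.from (iso 0F 1F (s≤s z≤n)) (s≤s (s≤s (s≤s (s≤s z≤n)))))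
  (Equivalence.from (iso 1F 2F (s≤s (s≤s z≤n))) (s≤s (s≤s (s≤s z≤n))))
  (Equivalence.from (iso 2F 3F (s≤s (s≤s (s≤s z≤n)))) (s≤s (s≤s z≤n)))

has4321⇒contains : ∀ {w} → Has4321 w → Contains w p4321
has4321⇒contains (has4321 {a} {b} {c} {d} occ b<a c<b d<c) = _ , occ , refl , iso
  where
  iso : ∀ s t → s Fin.< t →
    (List.lookup (a ∷ b ∷ c ∷ d ∷ []) s > List.lookup (a ∷ b ∷ c ∷ d ∷ []) t) ⇔
    (List.lookup p4321 (cast refl s) > List.lookup p4321 (cast refl t))
  iso 0F 1F _ = mk⇔ (λ _ → s≤s (s≤s (s≤s (s≤s z≤n)))) (λ _ → b<a)
  iso 0F 2F _ = mk⇔ (λ _ → s≤s (s≤s (s≤s z≤n))) (λ _ → <-trans c<b b<a)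
  iso 0F 3F _ = mk⇔ (λ _ → s≤s (s≤s z≤n)) (λ _ → <-trans d<c (<-trans c<b b<a))
  iso 1F 2F _ = mk⇔ (λ _ → s≤s (s≤s (s≤s z≤n))) (λ _ → c<b)
  iso 1F 3F _ = mk⇔ (λ _ → s≤s (s≤s z≤n)) (λ _ → <-trans d<c c<b)
  iso 2F 3F _ = mk⇔ (λ _ → s≤s (s≤s z≤n)) (λ _ → d<c)
  iso 0F 0F ()
  iso 1F 0F ()
  iso 1F 1F (s≤s ())
  iso 2F 0F ()
  iso 2F 1F (s≤s ())
  iso 2F 2F (s≤s (s≤s ()))
  iso 3F 0F ()
  iso 3F 1F (s≤s ())
  iso 3F 2F (s≤s (s≤s ()))
  iso 3F 3F (s≤s (s≤s (s≤s ())))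

Has213-resp-⊆ : ∀ {u w} → u ⊆ w → Has213 u → Has213 w
Has213-resp-⊆ u⊆w (has213 occ b<a a<c) = has213 (⊆-trans occ u⊆w) b<a a<c

has213-raise⁺ : ∀ {w} → Has213 w → Has213 (map raise w)
has213-raise⁺ (has213 occ b<a a<c) = has213 (map⁺ raise occ) (raise-mono-< b<a) (raise-mono-< a<c)

has213-raise⁻ : ∀ {w} → Has213 (map raise w) → Has213 w
has213-raise⁻ {w} (has213 occ b<a a<c) with ⊆-map⁻ raise w occ
... | _ ∷ _ ∷ _ ∷ [] , occ′ , refl = has213 occ′ (raise-cancel-< b<a) (raise-cancel-< a<c)

-- Arcs and chains

-- The arcs (x , π x) of the cyclic permutation π with standard cycle form 1 t.
arcs : List ℕ → List (ℕ × ℕ)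
arcs t = adjacent (1 ∷ t ++ 1 ∷ [])

infix 4 _≺_
_≺_ : ℕ × ℕ → ℕ × ℕ → Set
(x , y) ≺ (x′ , y′) = x < x′ × y′ < y

-- Among the arcs of π, these are the occurrences of 4321 in the one-line notation of π.
record Chain4321 (A : List (ℕ × ℕ)) : Set where
  constructor chain
  field
    {p₁ p₂ p₃ p₄} : ℕ × ℕ
    p₁∈   : p₁ ∈ A
    p₂∈   : p₂ ∈ A
    p₃∈   : p₃ ∈ A
    p₄∈   : p₄ ∈ A
    p₁≺p₂ : p₁ ≺ p₂
    p₂≺p₃ : p₂ ≺ p₃
    p₃≺p₄ : p₃ ≺ p₄

MonotoneOn : (ℕ → Set) → (ℕ → ℕ) → Set
MonotoneOn P f = ∀ {x y} → P x → P y → x < y → f x < f y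

chain-map : ∀ {A B} {P Q : ℕ → Set} (f g : ℕ → ℕ) → MonotoneOn P f → MonotoneOn Q g →
  (∀ {x y} → (x , y) ∈ A → P x × Q y × (f x , g y) ∈ B) → Chain4321 A → Chain4321 B
chain-map {A} {B} f g f-mono g-mono image (chain m₁ m₂ m₃ m₄ l₁₂ l₂₃ l₃₄) =
  chain (mapped m₁) (mapped m₂) (mapped m₃) (mapped m₄)
        (map-≺ m₁ m₂ l₁₂) (map-≺ m₂ m₃ l₂₃) (map-≺ m₃ m₄ l₃₄)
  where
  mapped : ∀ {x y} → (x , y) ∈ A → (f x , g y) ∈ B
  mapped m = proj₂ (proj₂ (image m))
  map-≺ : ∀ {x y x′ y′} → (x , y) ∈ A → (x′ , y′) ∈ A →
          (x , y) ≺ (x′ , y′) → (f x , g y) ≺ (f x′ , g y′)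
  map-≺ m m′ (x<x′ , y′<y) with image m | image m′
  ... | Px , Qy , _ | Px′ , Qy′ , _ = f-mono Px Px′ x<x′ , g-mono Qy′ Qy y′<y

chain-drop : ∀ {A B q} → (∀ {p} → p ∈ A → p ≢ q → p ∈ B) → (c : Chain4321 A) →
  Chain4321.p₁ c ≢ q → Chain4321.p₂ c ≢ q → Chain4321.p₃ c ≢ q → Chain4321.p₄ c ≢ q → Chain4321 B
chain-drop keep (chain m₁ m₂ m₃ m₄ l₁₂ l₂₃ l₃₄) n₁ n₂ n₃ n₄ =
  chain (keep m₁ n₁) (keep m₂ n₂) (keep m₃ n₃) (keep m₄ n₄) l₁₂ l₂₃ l₃₄

Positive : List (ℕ × ℕ) → Set
Positive A = ∀ {x y} → (x , y) ∈ A → 1 ≤ x × 1 ≤ y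

module ChainBounds {A : List (ℕ × ℕ)} (pos : Positive A) (c : Chain4321 A) where
  open Chain4321 c

  2≤x₂ : 2 ≤ proj₁ p₂
  2≤x₂ = ≤-trans (s≤s (proj₁ (pos p₁∈))) (proj₁ p₁≺p₂)

  3≤x₃ : 3 ≤ proj₁ p₃
  3≤x₃ = ≤-trans (s≤s 2≤x₂) (proj₁ p₂≺p₃)

  4≤x₄ : 4 ≤ proj₁ p₄
  4≤x₄ = ≤-trans (s≤s 3≤x₃) (proj₁ p₃≺p₄)

  2≤y₃ : 2 ≤ proj₂ p₃
  2≤y₃ = ≤-trans (s≤s (proj₂ (pos p₄∈))) (proj₂ p₃≺p₄)

  3≤y₂ : 3 ≤ proj₂ p₂
  3≤y₂ = ≤-trans (s≤s 2≤y₃) (proj₂ p₂≺p₃)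

  4≤y₁ : 4 ≤ proj₂ p₁
  4≤y₁ = ≤-trans (s≤s 3≤y₂) (proj₂ p₁≺p₂)

arcs-positive : ∀ t → All (1 ≤_) t → Positive (arcs t)
arcs-positive t t≥1 m = source≥1 (adjacent-source∈ 1 t 1 m) , target≥1 (adjacent-target∈ 1 (t ++ 1 ∷ []) m)
  where
  source≥1 : ∀ {x} → x ∈ 1 ∷ t → 1 ≤ x
  source≥1 (here refl) = s≤s z≤n
  source≥1 (there m)   = All.lookup t≥1 m
  target≥1 : ∀ {y} → y ∈ t ++ 1 ∷ [] → 1 ≤ y
  target≥1 = All.lookup (AllP.++⁺ t≥1 (s≤s z≤n ∷ []))

arcs-raise : ∀ t → arcs (map raise t) ≡ map (Product.map raise raise) (arcs t)
arcs-raise t = trans (cong (λ w → adjacent (1 ∷ w)) (sym (map-++ raise t (1 ∷ [])))) (adjacent-map raise (1 ∷ t ++ 1 ∷ []))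

chain-raise⁺ : ∀ {t} → Chain4321 (arcs t) → Chain4321 (arcs (map raise t))
chain-raise⁺ {t} = chain-map raise raise (λ _ _ → raise-mono-<) (λ _ _ → raise-mono-<)
  (λ m → tt , tt , subst (_ ∈_) (sym (arcs-raise t)) (∈-map⁺ (Product.map raise raise) m))

chain-raise⁻ : ∀ {t} → Chain4321 (arcs (map raise t)) → Chain4321 (arcs t)
chain-raise⁻ {t} c = chain-map lower lower lower-mono-< lower-mono-< lowered (subst Chain4321 (arcs-raise t) c)
  where
  lowered : ∀ {x y} → (x , y) ∈ map (Product.map raise raise) (arcs t) → x ≢ 2 × y ≢ 2 × (lower x , lower y) ∈ arcs t
  lowered m with ∈-map⁻ (Product.map raise raise) m
  ... | (x , y) , m′ , refl =
    raise≢2 x , raise≢2 y , subst₂ (λ x′ y′ → (x′ , y′) ∈ arcs t) (sym (lower-raise x)) (sym (lower-raise y)) m′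

-- Inserting 2 into a word with letters above 2

-- transpose k exchanges the adjacent values k and k + 1, so it keeps the order of any set that
-- contains only one of them; this is how chains move between the arcs with and without 2.
transpose : ℕ → ℕ → ℕ
transpose k x with x ≟ k | x ≟ suc k
... | yes _ | _     = suc k
... | no _  | yes _ = k
... | no _  | no _  = x

transpose-id : ∀ k {x} → x ≢ k → x ≢ suc k → transpose k x ≡ x
transpose-id k {x} x≢k x≢k+1 with x ≟ k | x ≟ suc k
... | yes x≡k | _         = ⊥-elim (x≢k x≡k)
... | no _    | yes x≡k+1 = ⊥-elim (x≢k+1 x≡k+1)
... | no _    | no _      = refl

transpose-above : ∀ k {x} → suc k < x → transpose k x ≡ x
transpose-above k k+1<x = transpose-id k (>⇒≢ (<-trans (n<1+n k) k+1<x)) (>⇒≢ k+1<x)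

transpose-mono-< : ∀ k {x y} → x < y → ¬ (x ≡ k × y ≡ suc k) → transpose k x < transpose k y
transpose-mono-< k {x} {y} x<y not-k,k+1 with x ≟ k | x ≟ suc k | y ≟ k | y ≟ suc k
... | yes refl | _        | yes refl | _        = ⊥-elim (<-irrefl refl x<y)
... | yes refl | _        | no _     | yes refl = ⊥-elim (not-k,k+1 (refl , refl))
... | yes refl | _        | no _     | no y≢k+1 = ≤∧≢⇒< x<y (λ e → y≢k+1 (sym e))
... | no _     | yes refl | yes refl | _        = ⊥-elim (<-asym x<y (n<1+n k))
... | no _     | yes refl | no _     | yes refl = ⊥-elim (<-irrefl refl x<y)
... | no _     | yes refl | no _     | no _     = <-trans (n<1+n k) x<y
... | no _     | no _     | yes refl | _        = <-trans x<y (n<1+n k)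
... | no x≢k   | no _     | no _     | yes refl = ≤∧≢⇒< (≤-pred x<y) x≢k
... | no _     | no _     | no _     | no _     = x<y

transpose-monotone-≢ : ∀ k → MonotoneOn (_≢ k) (transpose k)
transpose-monotone-≢ k x≢k _ x<y = transpose-mono-< k x<y (λ (x≡k , _) → x≢k x≡k)

transpose-monotone-≢suc : ∀ k → MonotoneOn (_≢ suc k) (transpose k)
transpose-monotone-≢suc k _ y≢k+1 x<y = transpose-mono-< k x<y (λ (_ , y≡k+1) → y≢k+1 y≡k+1)

id-monotone : MonotoneOn U (λ x → x)
id-monotone _ _ x<y = x<y

<⇒∉ : ∀ {k xs} → All (k <_) xs → k ∉ xs
<⇒∉ k<xs m = <-irrefl refl (All.lookup k<xs m)

source-≢ : ∀ {p : ℕ × ℕ} {x y} → x < proj₁ p → p ≢ (x , y)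
source-≢ x<x refl = <-irrefl refl x<x

target-≢ : ∀ {p : ℕ × ℕ} {x y} → y < proj₂ p → p ≢ (x , y)
target-≢ y<y refl = <-irrefl refl y<y

has213-insert2⁻ : ∀ X Y → All (2 <_) X → All (2 <_) Y → Has213 (X ++ 2 ∷ Y) →
  Has213 (X ++ Y) ⊎ ∃₂ λ a c → a ∈ X × c ∈ Y × a < c
has213-insert2⁻ X Y X>2 Y>2 (has213 {a} {b} {c} occ b<a a<c) with b ≟ 2
... | yes refl = let a∈X , c⊆Y = ⊆-around X Y (<⇒∉ X>2) (<⇒∉ Y>2) occ in inj₂ (a , c , a∈X , ∷⊆⇒∈ c⊆Y , a<c)
... | no b≢2 = inj₁ (has213 (⊆-remove X Y (a≢2 ∷ b≢2 ∷ c≢2 ∷ []) occ) b<a a<c)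
  where
  2≤b : 2 ≤ b
  2≤b = All.lookup (AllP.++⁺ (All.map <⇒≤ X>2) (≤-refl ∷ All.map <⇒≤ Y>2)) (∷⊆⇒∈ (∷ˡ⁻ occ))
  a≢2 : a ≢ 2
  a≢2 refl = <⇒≱ b<a 2≤b
  c≢2 : c ≢ 2
  c≢2 refl = <⇒≱ (<-trans b<a a<c) 2≤b

module Insert2Front (x : ℕ) (s : List ℕ) (x∷s>2 : All (2 <_) (x ∷ s)) where

  R : List (ℕ × ℕ)
  R = adjacent (x ∷ s ++ 1 ∷ [])

  R-source>2 : ∀ {a b} → (a , b) ∈ R → 2 < a
  R-source>2 m = All.lookup x∷s>2 (adjacent-source∈ x s 1 m)

  R-fixed : ∀ {a b} → (a , b) ∈ R → (transpose 1 a , b) ∈ R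
  R-fixed m = subst (λ a′ → (a′ , _) ∈ R) (sym (transpose-above 1 (R-source>2 m))) m

  has213⁺ : Has213 (x ∷ s) → Has213 (2 ∷ x ∷ s)
  has213⁺ = Has213-resp-⊆ (2 ∷ʳ ⊆-refl)

  has213⁻ : Has213 (2 ∷ x ∷ s) → Has213 (x ∷ s)
  has213⁻ h with has213-insert2⁻ [] (x ∷ s) [] x∷s>2 h
  ... | inj₁ h′ = h′
  ... | inj₂ (_ , _ , () , _)

  chain⁺ : Chain4321 (arcs (x ∷ s)) → Chain4321 (arcs (2 ∷ x ∷ s))
  chain⁺ = chain-map (transpose 1) (λ y → y) (transpose-monotone-≢suc 1) id-monotone image
    where
    image : ∀ {a b} → (a , b) ∈ (1 , x) ∷ R → a ≢ 2 × U b × (transpose 1 a , b) ∈ (1 , 2) ∷ (2 , x) ∷ R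
    image (here refl) = (λ ()) , tt , there (here refl)
    image (there m)   = >⇒≢ (R-source>2 m) , tt , there (there (R-fixed m))

  chain⁻ : Chain4321 (arcs (2 ∷ x ∷ s)) → Chain4321 (arcs (x ∷ s))
  chain⁻ c = chain-map (transpose 1) (λ y → y) (transpose-monotone-≢ 1) id-monotone image
    (chain-drop keep c (target-≢ (<⇒≤ 4≤y₁)) (source-≢ 2≤x₂)
                       (source-≢ (<⇒≤ 3≤x₃)) (source-≢ (<⇒≤ (<⇒≤ 4≤x₄))))
    where
    open ChainBounds (arcs-positive (2 ∷ x ∷ s) (s≤s z≤n ∷ All.map (≤-trans (s≤s z≤n)) x∷s>2)) c
    keep : ∀ {p} → p ∈ (1 , 2) ∷ (2 , x) ∷ R → p ≢ (1 , 2) → p ∈ (2 , x) ∷ R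
    keep (here refl) ≢ = ⊥-elim (≢ refl)
    keep (there m)   _ = m
    image : ∀ {a b} → (a , b) ∈ (2 , x) ∷ R → a ≢ 1 × U b × (transpose 1 a , b) ∈ (1 , x) ∷ R
    image (here refl) = (λ ()) , tt , here refl
    image (there m)   = >⇒≢ (<-trans (n<1+n 1) (R-source>2 m)) , tt , there (R-fixed m)

module Insert2Back (s : List ℕ) (s>2 : All (2 <_) s) where

  P : List (ℕ × ℕ)
  P = adjacent (1 ∷ s)

  z : ℕ
  z = lastOf 1 s

  arcs-s : arcs s ≡ P ++ (z , 1) ∷ []
  arcs-s = adjacent-++ 1 s 1 []

  arcs-t : arcs (s ++ 2 ∷ []) ≡ P ++ (z , 2) ∷ (2 , 1) ∷ []
  arcs-t = trans (cong (λ w → adjacent (1 ∷ w)) (++-assoc s (2 ∷ []) (1 ∷ []))) (adjacent-++ 1 s 2 (1 ∷ []))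

  P-target>2 : ∀ {a b} → (a , b) ∈ P → 2 < b
  P-target>2 m = All.lookup s>2 (adjacent-target∈ 1 s m)

  P-fixed : ∀ {a b} → (a , b) ∈ P → (a , transpose 1 b) ∈ P
  P-fixed m = subst (λ b′ → (_ , b′) ∈ P) (sym (transpose-above 1 (P-target>2 m))) m

  has213⁺ : Has213 s → Has213 (s ++ 2 ∷ [])
  has213⁺ = Has213-resp-⊆ (++⁺ʳ (2 ∷ []) ⊆-refl)

  has213⁻ : Has213 (s ++ 2 ∷ []) → Has213 s
  has213⁻ h with has213-insert2⁻ s [] s>2 [] h
  ... | inj₁ h′ = subst Has213 (++-identityʳ s) h′
  ... | inj₂ (_ , _ , _ , () , _)

  chain⁺ : Chain4321 (arcs s) → Chain4321 (arcs (s ++ 2 ∷ []))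
  chain⁺ c = subst Chain4321 (sym arcs-t)
    (chain-map (λ x → x) (transpose 1) id-monotone (transpose-monotone-≢suc 1) image (subst Chain4321 arcs-s c))
    where
    image : ∀ {a b} → (a , b) ∈ P ++ (z , 1) ∷ [] → U a × b ≢ 2 × (a , transpose 1 b) ∈ P ++ (z , 2) ∷ (2 , 1) ∷ []
    image m with ∈-++⁻ P m
    ... | inj₁ m′          = tt , >⇒≢ (P-target>2 m′) , ∈-++⁺ˡ (P-fixed m′)
    ... | inj₂ (here refl) = tt , (λ ()) , ∈-++⁺ʳ P (here refl)

  chain⁻ : Chain4321 (arcs (s ++ 2 ∷ [])) → Chain4321 (arcs s)
  chain⁻ c = subst Chain4321 (sym arcs-s)
    (chain-map (λ x → x) (transpose 1) id-monotone (transpose-monotone-≢ 1) image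
      (chain-drop keep c′ (target-≢ (<⇒≤ (<⇒≤ 4≤y₁))) (target-≢ (<⇒≤ 3≤y₂))
                          (target-≢ 2≤y₃) (source-≢ (<⇒≤ 4≤x₄))))
    where
    c′ : Chain4321 (P ++ (z , 2) ∷ (2 , 1) ∷ [])
    c′ = subst Chain4321 arcs-t c
    open ChainBounds (subst Positive arcs-t (arcs-positive (s ++ 2 ∷ [])
                       (AllP.++⁺ (All.map (≤-trans (s≤s z≤n)) s>2) (s≤s z≤n ∷ [])))) c′
    keep : ∀ {p} → p ∈ P ++ (z , 2) ∷ (2 , 1) ∷ [] → p ≢ (2 , 1) → p ∈ P ++ (z , 2) ∷ []
    keep m ≢ with ∈-++⁻ P m
    ... | inj₁ m′                  = ∈-++⁺ˡ m′
    ... | inj₂ (here refl)         = ∈-++⁺ʳ P (here refl)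
    ... | inj₂ (there (here refl)) = ⊥-elim (≢ refl)
    image : ∀ {a b} → (a , b) ∈ P ++ (z , 2) ∷ [] → U a × b ≢ 1 × (a , transpose 1 b) ∈ P ++ (z , 1) ∷ []
    image m with ∈-++⁻ P m
    ... | inj₁ m′          = tt , >⇒≢ (<-trans (n<1+n 1) (P-target>2 m′)) , ∈-++⁺ˡ (P-fixed m′)
    ... | inj₂ (here refl) = tt , (λ ()) , ∈-++⁺ʳ P (here refl)

module Insert2Before3 (u₀ : ℕ) (u v : List ℕ) (u>3 : All (3 <_) (u₀ ∷ u)) (v>3 : All (3 <_) v) where

  P Q : List (ℕ × ℕ)
  P = adjacent (1 ∷ u₀ ∷ u)
  Q = adjacent (3 ∷ v ++ 1 ∷ [])

  z : ℕ
  z = lastOf u₀ u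

  arcs-s : arcs (u₀ ∷ u ++ 3 ∷ v) ≡ P ++ (z , 3) ∷ Q
  arcs-s = trans (cong (λ w → adjacent (1 ∷ w)) (++-assoc (u₀ ∷ u) (3 ∷ v) (1 ∷ [])))
                 (adjacent-++ 1 (u₀ ∷ u) 3 (v ++ 1 ∷ []))

  arcs-t : arcs (u₀ ∷ u ++ 2 ∷ 3 ∷ v) ≡ P ++ (z , 2) ∷ (2 , 3) ∷ Q
  arcs-t = trans (cong (λ w → adjacent (1 ∷ w)) (++-assoc (u₀ ∷ u) (2 ∷ 3 ∷ v) (1 ∷ [])))
                 (adjacent-++ 1 (u₀ ∷ u) 2 (3 ∷ v ++ 1 ∷ []))

  P-target>3 : ∀ {a b} → (a , b) ∈ P → 3 < b
  P-target>3 m = All.lookup u>3 (adjacent-target∈ 1 (u₀ ∷ u) m)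

  Q-target : ∀ {a b} → (a , b) ∈ Q → b ≡ 1 ⊎ 3 < b
  Q-target m with ∈-++⁻ v (adjacent-target∈ 3 (v ++ 1 ∷ []) m)
  ... | inj₁ b∈v         = inj₂ (All.lookup v>3 b∈v)
  ... | inj₂ (here refl) = inj₁ refl

  fixed : ∀ {A : List (ℕ × ℕ)} {a b} → (a , b) ∈ A → 3 < b → (a , transpose 2 b) ∈ A
  fixed m b>3 = subst (λ b′ → (_ , b′) ∈ _) (sym (transpose-above 2 b>3)) m

  has213⁺ : Has213 (u₀ ∷ u ++ 3 ∷ v) → Has213 (u₀ ∷ u ++ 2 ∷ 3 ∷ v)
  has213⁺ = Has213-resp-⊆ (++⁺ (⊆-refl {x = u₀ ∷ u}) (2 ∷ʳ ⊆-refl))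

  has213⁻ : Has213 (u₀ ∷ u ++ 2 ∷ 3 ∷ v) → Has213 (u₀ ∷ u ++ 3 ∷ v)
  has213⁻ h with has213-insert2⁻ (u₀ ∷ u) (3 ∷ v) (All.map (<-trans (n<1+n 2)) u>3)
                                  (≤-refl ∷ All.map (<-trans (n<1+n 2)) v>3) h
  ... | inj₁ h′ = h′
  ... | inj₂ (a , _ , a∈u , here refl , a<3)  = ⊥-elim (<-asym a<3 (All.lookup u>3 a∈u))
  ... | inj₂ (a , c , a∈u , there c∈v , a<c) = has213 (++⁺ (from∈ a∈u) (refl ∷ from∈ c∈v)) (All.lookup u>3 a∈u) a<c

  chain⁺ : Chain4321 (arcs (u₀ ∷ u ++ 3 ∷ v)) → Chain4321 (arcs (u₀ ∷ u ++ 2 ∷ 3 ∷ v))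
  chain⁺ c = subst Chain4321 (sym arcs-t)
    (chain-map (λ x → x) (transpose 2) id-monotone (transpose-monotone-≢ 2) image (subst Chain4321 arcs-s c))
    where
    image : ∀ {a b} → (a , b) ∈ P ++ (z , 3) ∷ Q → U a × b ≢ 2 × (a , transpose 2 b) ∈ P ++ (z , 2) ∷ (2 , 3) ∷ Q
    image m with ∈-++⁻ P m
    ... | inj₁ m′          = tt , >⇒≢ (<-trans (n<1+n 2) (P-target>3 m′)) , ∈-++⁺ˡ (fixed m′ (P-target>3 m′))
    ... | inj₂ (here refl) = tt , (λ ()) , ∈-++⁺ʳ P (here refl)
    ... | inj₂ (there m′) with Q-target m′
    ...   | inj₁ refl = tt , (λ ()) , ∈-++⁺ʳ P (there (there m′))
    ...   | inj₂ b>3  = tt , >⇒≢ (<-trans (n<1+n 2) b>3) , ∈-++⁺ʳ P (there (there (fixed m′ b>3)))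

  A : List (ℕ × ℕ)
  A = P ++ (z , 2) ∷ (2 , 3) ∷ Q

  A-positive : Positive A
  A-positive = subst Positive arcs-t (arcs-positive (u₀ ∷ u ++ 2 ∷ 3 ∷ v)
    (AllP.++⁺ (All.map (≤-trans (s≤s z≤n)) u>3) (s≤s z≤n ∷ s≤s z≤n ∷ All.map (≤-trans (s≤s z≤n)) v>3)))

  source-of-target2 : ∀ {a} → (a , 2) ∈ A → a ≡ z
  source-of-target2 m with ∈-++⁻ P m
  ... | inj₁ m′                  = ⊥-elim (<-asym (P-target>3 m′) (n<1+n 2))
  ... | inj₂ (here refl)         = refl
  ... | inj₂ (there (there m′)) with Q-target m′
  ...   | inj₂ 2>3 = ⊥-elim (<-asym 2>3 (n<1+n 2))

  source-of-target1 : ∀ {a} → (a , 1) ∈ A → a ∈ 3 ∷ v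
  source-of-target1 m with ∈-++⁻ P m
  ... | inj₁ m′                  = ⊥-elim (<-asym (P-target>3 m′) (<-trans (n<1+n 1) (n<1+n 2)))
  ... | inj₂ (there (there m′))  = adjacent-source∈ 3 v 1 m′

  -- An arc (2 , 3) in the middle of a chain would force the arcs (z , 2) and (x , 1) after it,
  -- and then z 2 x is an occurrence of 213.
  middle-arc-not-23 : ¬ Has213 (u₀ ∷ u ++ 2 ∷ 3 ∷ v) → (c : Chain4321 A) → Chain4321.p₂ c ≢ (2 , 3)
  middle-arc-not-23 no213 (chain {p₃ = x₃ , y₃} {p₄ = x₄ , y₄} _ _ m₃ m₄ _ (_ , y₃<3) (x₃<x₄ , y₄<y₃)) refl
    with ≤-antisym (≤-pred y₃<3) (≤-trans (s≤s y₄≥1) y₄<y₃)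
    where
    y₄≥1 : 1 ≤ y₄
    y₄≥1 = proj₂ (A-positive m₄)
  ... | refl with ≤-antisym (≤-pred y₄<y₃) (proj₂ (A-positive m₄))
  ...   | refl = no213 (has213 (++⁺ (from∈ (lastOf∈ u₀ u)) (refl ∷ from∈ (source-of-target1 m₄)))
                               (<-trans (n<1+n 2) (All.lookup u>3 (lastOf∈ u₀ u)))
                               (subst (_< x₄) (source-of-target2 m₃) x₃<x₄))

  chain⁻ : ¬ Has213 (u₀ ∷ u ++ 2 ∷ 3 ∷ v) →
           Chain4321 (arcs (u₀ ∷ u ++ 2 ∷ 3 ∷ v)) → Chain4321 (arcs (u₀ ∷ u ++ 3 ∷ v))
  chain⁻ no213 c = subst Chain4321 (sym arcs-s)
    (chain-map (λ x → x) (transpose 2) id-monotone (transpose-monotone-≢suc 2) image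
      (chain-drop keep c′ (target-≢ 4≤y₁) (middle-arc-not-23 no213 c′) (source-≢ 3≤x₃) (source-≢ (<⇒≤ 4≤x₄))))
    where
    c′ : Chain4321 A
    c′ = subst Chain4321 arcs-t c
    open ChainBounds A-positive c′
    keep : ∀ {p} → p ∈ A → p ≢ (2 , 3) → p ∈ P ++ (z , 2) ∷ Q
    keep m ≢ with ∈-++⁻ P m
    ... | inj₁ m′                  = ∈-++⁺ˡ m′
    ... | inj₂ (here refl)         = ∈-++⁺ʳ P (here refl)
    ... | inj₂ (there (here refl)) = ⊥-elim (≢ refl)
    ... | inj₂ (there (there m′))  = ∈-++⁺ʳ P (there m′)
    image : ∀ {a b} → (a , b) ∈ P ++ (z , 2) ∷ Q → U a × b ≢ 3 × (a , transpose 2 b) ∈ P ++ (z , 3) ∷ Q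
    image m with ∈-++⁻ P m
    ... | inj₁ m′          = tt , >⇒≢ (P-target>3 m′) , ∈-++⁺ˡ (fixed m′ (P-target>3 m′))
    ... | inj₂ (here refl) = tt , (λ ()) , ∈-++⁺ʳ P (here refl)
    ... | inj₂ (there m′) with Q-target m′
    ...   | inj₁ refl = tt , (λ ()) , ∈-++⁺ʳ P (there m′)
    ...   | inj₂ b>3  = tt , >⇒≢ b>3 , ∈-++⁺ʳ P (there (fixed m′ b>3))

-- Admissible tails and their children

raise-above2 : ∀ {p} → All (1 <_) p → All (2 <_) (map raise p)
raise-above2 = AllP.map⁺ ∘ All.map (λ 1<x → subst (2 <_) (sym (raise-≥2 1<x)) (s≤s 1<x))

raise-above3 : ∀ {p} → All (2 <_) p → All (3 <_) (map raise p)
raise-above3 = AllP.map⁺ ∘ All.map (λ 2<x → subst (3 <_) (sym (raise-≥2 (<⇒≤ 2<x))) (s≤s 2<x))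

2≤raise⁻ : ∀ {x} → 2 ≤ raise x → 2 ≤ x
2≤raise⁻ {suc (suc x)} _ = s≤s (s≤s z≤n)
2≤raise⁻ {1}           (s≤s ())

-- t lists each of 2, …, n exactly once, so that 1 t is the standard cycle form of a cyclic permutation.
record Arrangement (n : ℕ) (t : List ℕ) : Set where
  constructor arrangement
  field
    unique   : Unique t
    bounded  : ∀ {x} → x ∈ t → 2 ≤ x × x ≤ n
    complete : ∀ {x} → 2 ≤ x → x ≤ n → x ∈ t

  values>1 : All (1 <_) t
  values>1 = All.tabulate (proj₁ ∘ bounded)

  1∉ : 1 ∉ t
  1∉ = <⇒∉ values>1

  unique-1∷ : Unique (1 ∷ t)
  unique-1∷ = AllP.¬Any⇒All¬ t 1∉ ∷ unique

open Arrangement using (values>1)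

module _ {n : ℕ} {p : List ℕ} (X Y : List ℕ) (split : map raise p ≡ X ++ Y) where

  raised-∈⁻ : ∀ {y} → y ∈ X ++ Y → ∃ λ x → x ∈ p × raise x ≡ y
  raised-∈⁻ m = let x , x∈p , y≡ = ∈-map⁻ raise (subst (_ ∈_) (sym split) m) in x , x∈p , sym y≡

  raised-∈⁺ : ∀ {x} → x ∈ p → raise x ∈ X ++ Y
  raised-∈⁺ x∈p = subst (_ ∈_) split (∈-map⁺ raise x∈p)

  arrangement-insert2 : 1 ≤ n → Arrangement n p → Arrangement (suc n) (X ++ 2 ∷ Y)
  arrangement-insert2 n≥1 (arrangement u bd cv) = arrangement
    (Unique-insert X Y (λ m → let x , _ , e = raised-∈⁻ m in raise≢2 x e) (subst Unique split (Unique.map⁺ raise-injective u)))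
    bounded
    complete
    where
    bounded : ∀ {y} → y ∈ X ++ 2 ∷ Y → 2 ≤ y × y ≤ suc n
    bounded m with ∈-insert⁻ X Y m
    ... | inj₁ refl = ≤-refl , s≤s n≥1
    ... | inj₂ m′ with raised-∈⁻ m′
    ...   | x , x∈p , refl with bd x∈p
    ...     | 2≤x , x≤n rewrite raise-≥2 2≤x = ≤-trans 2≤x (n≤1+n x) , s≤s x≤n
    complete : ∀ {y} → 2 ≤ y → y ≤ suc n → y ∈ X ++ 2 ∷ Y
    complete {1}                 (s≤s ())
    complete {2}                 _ _           = ∈-insert X
    complete {suc (suc (suc x))} _ (s≤s x+2≤n) = ∈-insert⁺ X Y (raised-∈⁺ (cv (s≤s (s≤s z≤n)) x+2≤n))

  arrangement-remove2 : Arrangement (suc n) (X ++ 2 ∷ Y) → Arrangement n p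
  arrangement-remove2 (arrangement u bd cv) = arrangement
    (Unique.map⁻ (subst Unique (sym split) (Unique-remove X Y u)))
    bounded
    complete
    where
    bounded : ∀ {x} → x ∈ p → 2 ≤ x × x ≤ n
    bounded x∈p with bd (∈-insert⁺ X Y (raised-∈⁺ x∈p))
    ... | 2≤x+ , x+≤n+1 = 2≤raise⁻ 2≤x+ , ≤-pred (subst (_≤ suc n) (raise-≥2 (2≤raise⁻ 2≤x+)) x+≤n+1)
    complete : ∀ {x} → 2 ≤ x → x ≤ n → x ∈ p
    complete {x} 2≤x x≤n with ∈-insert⁻ X Y (cv (≤-trans 2≤x (n≤1+n x)) (s≤s x≤n))
    ... | inj₁ x+1≡2 = ⊥-elim (<-irrefl (sym x+1≡2) (s≤s 2≤x))
    ... | inj₂ m with raised-∈⁻ m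
    ...   | y , y∈p , raise-y≡x+1 = subst (_∈ p) (raise-injective (trans raise-y≡x+1 (sym (raise-≥2 2≤x)))) y∈p

empty-not-arrangement : ∀ {n} → 2 ≤ n → ¬ Arrangement n []
empty-not-arrangement n≥2 arr with Arrangement.complete arr ≤-refl n≥2
... | ()

All-<-∉ : ∀ {k xs} → suc k ∉ xs → All (k <_) xs → All (suc k <_) xs
All-<-∉ k+1∉xs xs>k = All.tabulate λ m → ≤∧≢⇒< (All.lookup xs>k m) (λ k+1≡x → k+1∉xs (subst (_∈ _) (sym k+1≡x) m))

arrangement-split2 : ∀ {n t} → 2 ≤ n → Arrangement n t →
  ∃₂ λ X Y → t ≡ X ++ 2 ∷ Y × All (2 <_) X × All (2 <_) Y
arrangement-split2 n≥2 arr with ∈-∃++ (Arrangement.complete arr ≤-refl n≥2)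
... | X , Y , refl with Unique-middle X Y (Arrangement.unique arr) | AllP.++⁻ X (values>1 arr)
...   | 2∉X , 2∉Y | X>1 , _ ∷ Y>1 = X , Y , refl , All-<-∉ 2∉X X>1 , All-<-∉ 2∉Y Y>1

record Admissible (n : ℕ) (t : List ℕ) : Set where
  constructor admissible
  field
    arranged   : Arrangement n t
    avoids213  : ¬ Has213 t
    chain-free : ¬ Chain4321 (arcs t)

prepend2 append2 insertBefore3 : List ℕ → List ℕ
prepend2 p = 2 ∷ map raise p
append2  p = map raise p ++ 2 ∷ []
insertBefore3 []      = []
insertBefore3 (x ∷ p) with x ≟ 2
... | yes _ = 2 ∷ 3 ∷ map raise p
... | no _  = raise x ∷ insertBefore3 p

insertBefore3-split : ∀ X Y → 2 ∉ X → insertBefore3 (X ++ 2 ∷ Y) ≡ map raise X ++ 2 ∷ 3 ∷ map raise Y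
insertBefore3-split []      Y _   = refl
insertBefore3-split (x ∷ X) Y 2∉ with x ≟ 2
... | yes refl = ⊥-elim (2∉ (here refl))
... | no _     = cong (raise x ∷_) (insertBefore3-split X Y (2∉ ∘ there))

prepend2-admissible⁺ : ∀ {n p} → 2 ≤ n → Admissible n p → Admissible (suc n) (prepend2 p)
prepend2-admissible⁺ {p = []}    n≥2 (admissible arr _ _) = ⊥-elim (empty-not-arrangement n≥2 arr)
prepend2-admissible⁺ {p = x ∷ p} n≥2 (admissible arr no213 no-chain) = admissible
  (arrangement-insert2 [] (map raise (x ∷ p)) refl (≤-trans (s≤s z≤n) n≥2) arr)
  (no213 ∘ has213-raise⁻ {x ∷ p} ∘ F.has213⁻)
  (no-chain ∘ chain-raise⁻ {x ∷ p} ∘ F.chain⁻)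
  where module F = Insert2Front (raise x) (map raise p) (raise-above2 (values>1 arr))

prepend2-admissible⁻ : ∀ {n p} → 2 ≤ n → Admissible (suc n) (prepend2 p) → Admissible n p
prepend2-admissible⁻ {p = []}    n≥2 (admissible arr _ _) =
  ⊥-elim (empty-not-arrangement n≥2 (arrangement-remove2 [] [] refl arr))
prepend2-admissible⁻ {n} {p = x ∷ p} n≥2 (admissible arr no213 no-chain) = admissible arr′
  (no213 ∘ F.has213⁺ ∘ has213-raise⁺)
  (no-chain ∘ F.chain⁺ ∘ chain-raise⁺ {x ∷ p})
  where
  arr′ : Arrangement n (x ∷ p)
  arr′ = arrangement-remove2 [] (map raise (x ∷ p)) refl arr
  module F = Insert2Front (raise x) (map raise p) (raise-above2 (values>1 arr′))

append2-admissible⁺ : ∀ {n p} → 2 ≤ n → Admissible n p → Admissible (suc n) (append2 p)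
append2-admissible⁺ {p = p} n≥2 (admissible arr no213 no-chain) = admissible
  (arrangement-insert2 (map raise p) [] (sym (++-identityʳ _)) (≤-trans (s≤s z≤n) n≥2) arr)
  (no213 ∘ has213-raise⁻ {p} ∘ B.has213⁻)
  (no-chain ∘ chain-raise⁻ {p} ∘ B.chain⁻)
  where module B = Insert2Back (map raise p) (raise-above2 (values>1 arr))

append2-admissible⁻ : ∀ {n p} → Admissible (suc n) (append2 p) → Admissible n p
append2-admissible⁻ {n} {p} (admissible arr no213 no-chain) = admissible arr′
  (no213 ∘ B.has213⁺ ∘ has213-raise⁺)
  (no-chain ∘ B.chain⁺ ∘ chain-raise⁺ {p})
  where
  arr′ : Arrangement n p
  arr′ = arrangement-remove2 (map raise p) [] (sym (++-identityʳ _)) arr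
  module B = Insert2Back (map raise p) (raise-above2 (values>1 arr′))

module MiddleChild {n : ℕ} (a : ℕ) (X Y : List ℕ) (a∷X>2 : All (2 <_) (a ∷ X)) (Y>2 : All (2 <_) Y) where

  p : List ℕ
  p = a ∷ X ++ 2 ∷ Y

  inserted : insertBefore3 p ≡ raise a ∷ map raise X ++ 2 ∷ 3 ∷ map raise Y
  inserted = insertBefore3-split (a ∷ X) Y (<⇒∉ a∷X>2)

  raised : map raise p ≡ (raise a ∷ map raise X) ++ 3 ∷ map raise Y
  raised = map-++ raise (a ∷ X) (2 ∷ Y)

  module B = Insert2Before3 (raise a) (map raise X) (map raise Y) (raise-above3 a∷X>2) (raise-above3 Y>2)

  admissible⁺ : 2 ≤ n → Admissible n p → Admissible (suc n) (insertBefore3 p)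
  admissible⁺ n≥2 (admissible arr no213 no-chain) = subst (Admissible (suc n)) (sym inserted) (admissible
    (arrangement-insert2 (raise a ∷ map raise X) (3 ∷ map raise Y) raised (≤-trans (s≤s z≤n) n≥2) arr)
    no213′
    (no-chain ∘ chain-raise⁻ {p} ∘ subst (Chain4321 ∘ arcs) (sym raised) ∘ B.chain⁻ no213′))
    where
    no213′ : ¬ Has213 (raise a ∷ map raise X ++ 2 ∷ 3 ∷ map raise Y)
    no213′ = no213 ∘ has213-raise⁻ {p} ∘ subst Has213 (sym raised) ∘ B.has213⁻

  admissible⁻ : Admissible (suc n) (insertBefore3 p) → Admissible n p
  admissible⁻ adm with subst (Admissible (suc n)) inserted adm
  ... | admissible arr no213 no-chain = admissible
    (arrangement-remove2 (raise a ∷ map raise X) (3 ∷ map raise Y) raised arr)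
    (no213 ∘ B.has213⁺ ∘ subst Has213 raised ∘ has213-raise⁺)
    (no-chain ∘ B.chain⁺ ∘ subst (Chain4321 ∘ arcs) raised ∘ chain-raise⁺ {p})

StartsWith2 : List ℕ → Set
StartsWith2 []      = ⊥
StartsWith2 (x ∷ _) = x ≡ 2

startsWith2? : ∀ p → Dec (StartsWith2 p)
startsWith2? []      = no λ ()
startsWith2? (x ∷ _) = x ≟ 2

-- The last alternative is excluded when p starts with 2, where it would repeat the first.
data Child (p : List ℕ) : List ℕ → Set where
  front  : Child p (prepend2 p)
  back   : Child p (append2 p)
  middle : ¬ StartsWith2 p → Child p (insertBefore3 p)

child-admissible : ∀ {n p t} → 2 ≤ n → Admissible n p → Child p t → Admissible (suc n) t
child-admissible n≥2 adm front      = prepend2-admissible⁺ n≥2 adm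
child-admissible n≥2 adm back       = append2-admissible⁺ n≥2 adm
child-admissible n≥2 adm (middle ¬2) with arrangement-split2 n≥2 (Admissible.arranged adm)
... | []    , _ , refl , _     , _   = ⊥-elim (¬2 refl)
... | a ∷ X , Y , refl , a∷X>2 , Y>2 = MiddleChild.admissible⁺ a X Y a∷X>2 Y>2 n≥2 adm

descent-across-2 : ∀ {t x y} → Unique t → ¬ Has213 t → x ∷ 2 ∷ y ∷ [] ⊆ t → 2 < x → y < x
descent-across-2 {x = x} {y} u no213 occ 2<x with <-cmp y x | Unique-resp-⊆ occ u
... | tri< y<x _ _ | _                     = y<x
... | tri≈ _ refl _ | (_ ∷ x≢x ∷ []) ∷ _   = ⊥-elim (x≢x refl)
... | tri> _ _ x<y | _                     = ⊥-elim (no213 (has213 occ 2<x x<y))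

-- The arcs (1 , u₀), (2 , b), (x , 3) and (z , 2), with x the letter before 3 and z the one before 2.
chain-from-late-3 : ∀ {n} u₀ U b W → let t = u₀ ∷ U ++ 2 ∷ b ∷ W in
  Arrangement n t → ¬ Has213 t → All (2 <_) (u₀ ∷ U) → All (2 <_) (b ∷ W) → 3 < b → 3 ∈ W → Chain4321 (arcs t)
chain-from-late-3 u₀ U b W arr no213 U>2 bW>2 b>3 3∈W with ∈-∃++ 3∈W
... | V₁ , V₂ , refl = subst Chain4321 (sym arcs-t) (chain
  (here refl)
  (∈-adjacent-right 1 (u₀ ∷ U) 2 _ (here refl))
  (∈-adjacent-right 1 (u₀ ∷ U) 2 _ (there (∈-adjacent-last b V₁ 3 _)))
  (∈-adjacent-last 1 (u₀ ∷ U) 2 _)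
  (s≤s (s≤s z≤n) , descent-across-2 u no213 (++⁺ (from∈ (here refl)) (refl ∷ from∈ (here refl))) (All.head U>2))
  (All.lookup bV₁>2 (lastOf∈ b V₁) , b>3)
  ( descent-across-2 u no213 (++⁺ (from∈ (lastOf∈ u₀ U)) (refl ∷ from∈ (∈-++⁺ˡ (lastOf∈ b V₁))))
                     (All.lookup U>2 (lastOf∈ u₀ U))
  , n<1+n 2))
  where
  u : Unique (u₀ ∷ U ++ 2 ∷ b ∷ V₁ ++ 3 ∷ V₂)
  u = Arrangement.unique arr
  bV₁>2 : All (2 <_) (b ∷ V₁)
  bV₁>2 = All.head bW>2 ∷ proj₁ (AllP.++⁻ V₁ (All.tail bW>2))
  arcs-t : arcs (u₀ ∷ U ++ 2 ∷ b ∷ V₁ ++ 3 ∷ V₂) ≡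
           adjacent (1 ∷ (u₀ ∷ U) ++ 2 ∷ b ∷ V₁ ++ 3 ∷ V₂ ++ 1 ∷ [])
  arcs-t = cong (λ w → adjacent (1 ∷ w)) (trans (++-assoc (u₀ ∷ U) (2 ∷ b ∷ V₁ ++ 3 ∷ V₂) (1 ∷ []))
                                               (cong (λ w → u₀ ∷ U ++ 2 ∷ b ∷ w) (++-assoc V₁ (3 ∷ V₂) (1 ∷ []))))

raise∘lower : ∀ {xs} → All (2 <_) xs → map raise (map lower xs) ≡ xs
raise∘lower []           = refl
raise∘lower (x>2 ∷ xs>2) = cong₂ _∷_ (raise-lower (>⇒≢ x>2)) (raise∘lower xs>2)

lower-above2 : ∀ {xs} → All (3 <_) xs → All (2 <_) (map lower xs)
lower-above2 = AllP.map⁺ ∘ All.map λ { (s≤s (s≤s (s≤s (s≤s _)))) → s≤s (s≤s (s≤s z≤n)) }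

2-followed-by-3 : ∀ {n} u₀ U b W → 2 ≤ n → Admissible (suc n) (u₀ ∷ U ++ 2 ∷ b ∷ W) →
  All (2 <_) (u₀ ∷ U) → All (2 <_) (b ∷ W) → b ≡ 3
2-followed-by-3 u₀ U b W n≥2 (admissible arr no213 no-chain) U>2 bW>2 with b ≟ 3
... | yes b≡3 = b≡3
... | no b≢3  = ⊥-elim (nowhere (∈-++⁻ (u₀ ∷ U) (Arrangement.complete arr (s≤s (s≤s z≤n)) (s≤s n≥2))))
  where
  b>3 : 3 < b
  b>3 = ≤∧≢⇒< (All.head bW>2) (b≢3 ∘ sym)
  nowhere : 3 ∈ u₀ ∷ U ⊎ 3 ∈ 2 ∷ b ∷ W → ⊥
  nowhere (inj₁ 3∈U)                = no213 (has213 (++⁺ (from∈ 3∈U) (refl ∷ refl ∷ minimum _)) (n<1+n 2) b>3)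
  nowhere (inj₂ (there (here 3≡b)))  = b≢3 (sym 3≡b)
  nowhere (inj₂ (there (there 3∈W))) = no-chain (chain-from-late-3 u₀ U b W arr no213 U>2 bW>2 b>3 3∈W)

parent-exists : ∀ {n t} → 2 ≤ n → Admissible (suc n) t → ∃ λ p → Admissible n p × Child p t
parent-exists {n} n≥2 adm with arrangement-split2 (≤-trans n≥2 (n≤1+n n)) (Admissible.arranged adm)
... | [] , W , refl , _ , W>2 =
  map lower W , prepend2-admissible⁻ n≥2 (subst (Admissible (suc n)) (sym e) adm) , subst (Child _) e front
  where
  e : prepend2 (map lower W) ≡ 2 ∷ W
  e = cong (2 ∷_) (raise∘lower W>2)
... | u₀ ∷ U , [] , refl , U>2 , _ =
  map lower (u₀ ∷ U) , append2-admissible⁻ (subst (Admissible (suc n)) (sym e) adm) , subst (Child _) e back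
  where
  e : append2 (map lower (u₀ ∷ U)) ≡ u₀ ∷ U ++ 2 ∷ []
  e = cong (_++ 2 ∷ []) (raise∘lower U>2)
... | u₀ ∷ U , b ∷ W , refl , U>2 , bW>2 with 2-followed-by-3 u₀ U b W n≥2 adm U>2 bW>2
...   | refl with Unique-middle (u₀ ∷ U) W (Unique-remove (u₀ ∷ U) (3 ∷ W) (Arrangement.unique (Admissible.arranged adm)))
...     | 3∉U , 3∉W =
  p , I.admissible⁻ (subst (Admissible (suc n)) (sym e) adm) , subst (Child p) e (middle (>⇒≢ (All.head a∷X>2)))
  where
  U>3 : All (3 <_) (u₀ ∷ U)
  U>3 = All-<-∉ 3∉U U>2
  a∷X>2 : All (2 <_) (lower u₀ ∷ map lower U)
  a∷X>2 = lower-above2 U>3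
  W>3 : All (3 <_) W
  W>3 = All-<-∉ 3∉W (All.tail bW>2)
  Y>2 : All (2 <_) (map lower W)
  Y>2 = lower-above2 W>3
  module I = MiddleChild {n} (lower u₀) (map lower U) (map lower W) a∷X>2 Y>2
  p : List ℕ
  p = I.p
  e : insertBefore3 p ≡ u₀ ∷ U ++ 2 ∷ 3 ∷ W
  e = trans I.inserted (cong₂ (λ X Y → X ++ 2 ∷ 3 ∷ Y) (raise∘lower U>2) (raise∘lower (All.map (<-trans (n<1+n 2)) W>3)))

¬startsWith2? : Decidable (∁ StartsWith2)
¬startsWith2? p = ¬? (startsWith2? p)

children : List (List ℕ) → List (List ℕ)
children W = map prepend2 W ++ map append2 W ++ map insertBefore3 (filter ¬startsWith2? W)

∈-children⁺ : ∀ {W p t} → p ∈ W → Child p t → t ∈ children W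
∈-children⁺ {W} p∈W front        = ∈-++⁺ˡ (∈-map⁺ prepend2 p∈W)
∈-children⁺ {W} p∈W back         = ∈-++⁺ʳ (map prepend2 W) (∈-++⁺ˡ (∈-map⁺ append2 p∈W))
∈-children⁺ {W} p∈W (middle ¬2) =
  ∈-++⁺ʳ (map prepend2 W) (∈-++⁺ʳ (map append2 W) (∈-map⁺ insertBefore3 (∈-filter⁺ ¬startsWith2? p∈W ¬2)))

∈-children⁻ : ∀ {W t} → t ∈ children W → ∃ λ p → p ∈ W × Child p t
∈-children⁻ {W} m with ∈-++⁻ (map prepend2 W) m
... | inj₁ m′ with ∈-map⁻ prepend2 m′
...   | p , p∈W , refl = p , p∈W , front
∈-children⁻ {W} m | inj₂ m′ with ∈-++⁻ (map append2 W) m′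
... | inj₁ m″ with ∈-map⁻ append2 m″
...   | p , p∈W , refl = p , p∈W , back
∈-children⁻ {W} m | inj₂ m′ | inj₂ m″ with ∈-map⁻ insertBefore3 m″
...   | p , p∈filter , refl = let p∈W , ¬2 = ∈-filter⁻ ¬startsWith2? p∈filter in p , p∈W , middle ¬2

admissibleWords : ℕ → List (List ℕ)
admissibleWords zero    = (2 ∷ []) ∷ []
admissibleWords (suc k) = children (admissibleWords k)

admissible-[2] : Admissible 2 (2 ∷ [])
admissible-[2] = admissible
  (arrangement ([] ∷ []) (λ { (here refl) → ≤-refl , ≤-refl }) (λ 2≤x x≤2 → here (≤-antisym x≤2 2≤x)))
  (λ { (has213 occ _ _) → case length-mono-≤ occ of λ { (s≤s ()) } })
  no-chain
  where
  no-chain : ¬ Chain4321 (arcs (2 ∷ []))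
  no-chain c with Chain4321.p₄∈ c | ChainBounds.4≤x₄ (arcs-positive (2 ∷ []) (s≤s z≤n ∷ [])) c
  ... | here refl         | s≤s ()
  ... | there (here refl) | s≤s (s≤s ())

admissible-2⁻ : ∀ {t} → Admissible 2 t → t ≡ 2 ∷ []
admissible-2⁻ {[]}        (admissible arr _ _) = ⊥-elim (empty-not-arrangement ≤-refl arr)
admissible-2⁻ {x ∷ []}    (admissible arr _ _) =
  let 2≤x , x≤2 = Arrangement.bounded arr (here refl) in cong (_∷ []) (≤-antisym x≤2 2≤x)
admissible-2⁻ {x ∷ y ∷ t} (admissible arr _ _)
  with Arrangement.bounded arr (here refl) | Arrangement.bounded arr (there (here refl)) | Arrangement.unique arr
... | 2≤x , x≤2 | 2≤y , y≤2 | (x≢y ∷ _) ∷ _ = ⊥-elim (x≢y (trans (≤-antisym x≤2 2≤x) (≤-antisym 2≤y y≤2)))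

admissibleWords-sound : ∀ k {t} → t ∈ admissibleWords k → Admissible (2 + k) t
admissibleWords-sound zero    (here refl) = admissible-[2]
admissibleWords-sound (suc k) m with ∈-children⁻ m
... | p , p∈W , child = child-admissible (s≤s (s≤s z≤n)) (admissibleWords-sound k p∈W) child

admissibleWords-complete : ∀ k {t} → Admissible (2 + k) t → t ∈ admissibleWords k
admissibleWords-complete zero    adm = here (admissible-2⁻ adm)
admissibleWords-complete (suc k) adm with parent-exists (s≤s (s≤s z≤n)) adm
... | p , adm-p , child = ∈-children⁺ (admissibleWords-complete k adm-p) child

remove2 : List ℕ → List ℕ
remove2 = filter (λ x → ¬? (x ≟ 2))

parent : List ℕ → List ℕ
parent t = map lower (remove2 t)

remove2-raise : ∀ p → remove2 (map raise p) ≡ map raise p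
remove2-raise p = filter-all (λ x → ¬? (x ≟ 2)) (AllP.map⁺ (All.tabulate {xs = p} λ {x} _ → raise≢2 x))

remove2-insertBefore3 : ∀ p → remove2 (insertBefore3 p) ≡ map raise p
remove2-insertBefore3 []      = refl
remove2-insertBefore3 (x ∷ p) with x ≟ 2
... | yes refl = cong (3 ∷_) (remove2-raise p)
... | no _     = trans (filter-accept (λ y → ¬? (y ≟ 2)) (raise≢2 x)) (cong (raise x ∷_) (remove2-insertBefore3 p))

lower∘raise : ∀ p → map lower (map raise p) ≡ p
lower∘raise p = trans (sym (map-∘ p)) (trans (map-cong lower-raise p) (map-id p))

parent-prepend2 : ∀ p → parent (prepend2 p) ≡ p
parent-prepend2 p = trans (cong (map lower) (remove2-raise p)) (lower∘raise p)

parent-append2 : ∀ p → parent (append2 p) ≡ p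
parent-append2 p = trans (cong (map lower) removed) (lower∘raise p)
  where
  removed : remove2 (map raise p ++ 2 ∷ []) ≡ map raise p
  removed = trans (filter-++ (λ x → ¬? (x ≟ 2)) (map raise p) (2 ∷ [])) (trans (cong (_++ []) (remove2-raise p)) (++-identityʳ _))

parent-insertBefore3 : ∀ p → parent (insertBefore3 p) ≡ p
parent-insertBefore3 p = trans (cong (map lower) (remove2-insertBefore3 p)) (lower∘raise p)

injective-by-parent : ∀ {f : List ℕ → List ℕ} → (∀ p → parent (f p) ≡ p) → ∀ {p q} → f p ≡ f q → p ≡ q
injective-by-parent parent∘f {p} {q} e = trans (sym (parent∘f p)) (trans (cong parent e) (parent∘f q))

insertBefore3-¬startsWith2 : ∀ {p} → ¬ StartsWith2 p → ¬ StartsWith2 (insertBefore3 p)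
insertBefore3-¬startsWith2 {[]}    _  = λ ()
insertBefore3-¬startsWith2 {x ∷ p} ¬2 with x ≟ 2
... | yes x≡2 = ⊥-elim (¬2 x≡2)
... | no _    = raise≢2 x

insertBefore3-lastOf : ∀ a p → 2 ∈ p → lastOf a (insertBefore3 p) ≢ 2
insertBefore3-lastOf a (x ∷ p) 2∈ with x ≟ 2
... | yes refl = not-2 (lastOf∈ 3 (map raise p))
  where
  not-2 : ∀ {y} → y ∈ 3 ∷ map raise p → y ≢ 2
  not-2 (here refl) ()
  not-2 (there m) with ∈-map⁻ raise m
  ... | z , _ , refl = raise≢2 z
... | no x≢2 with 2∈
...   | here 2≡x = ⊥-elim (x≢2 (sym 2≡x))
...   | there 2∈p = insertBefore3-lastOf (raise x) p 2∈p

module _ {n : ℕ} {W : List (List ℕ)} (n≥2 : 2 ≤ n) (adm : ∀ {p} → p ∈ W → Admissible n p) where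

  private
    later : List (List ℕ)
    later = map append2 W ++ map insertBefore3 (filter ¬startsWith2? W)

    2∈ : ∀ {p} → p ∈ W → 2 ∈ p
    2∈ p∈W = Arrangement.complete (Admissible.arranged (adm p∈W)) ≤-refl n≥2

  later-¬startsWith2 : ∀ {t} → t ∈ later → ¬ StartsWith2 t
  later-¬startsWith2 m with ∈-++⁻ (map append2 W) m
  ... | inj₁ m′ with ∈-map⁻ append2 m′
  ...   | x ∷ p , _ , refl = raise≢2 x
  ...   | [] , p∈W , refl = case 2∈ p∈W of λ ()
  later-¬startsWith2 m | inj₂ m′ with ∈-map⁻ insertBefore3 m′
  ...   | p , p∈filter , refl = insertBefore3-¬startsWith2 (proj₂ (∈-filter⁻ ¬startsWith2? {xs = W} p∈filter))

  children-unique : Unique W → Unique (children W)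
  children-unique u = Unique.++⁺ (Unique.map⁺ (injective-by-parent parent-prepend2) u)
    (Unique.++⁺ (Unique.map⁺ (injective-by-parent parent-append2) u)
                (Unique.map⁺ (injective-by-parent parent-insertBefore3) (Unique.filter⁺ ¬startsWith2? u))
                back∩middle)
    front∩later
    where
    front∩later : ∀ {t} → ¬ (t ∈ map prepend2 W × t ∈ later)
    front∩later (m₁ , m₂) with ∈-map⁻ prepend2 m₁
    ... | _ , _ , refl = later-¬startsWith2 m₂ refl
    back∩middle : ∀ {t} → ¬ (t ∈ map append2 W × t ∈ map insertBefore3 (filter ¬startsWith2? W))
    back∩middle (m₁ , m₂) with ∈-map⁻ append2 m₁ | ∈-map⁻ insertBefore3 m₂
    ... | p , _ , refl | q , q∈filter , e =
      insertBefore3-lastOf 0 q (2∈ (proj₁ (∈-filter⁻ ¬startsWith2? {xs = W} q∈filter)))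
        (trans (cong (lastOf 0) (sym e)) (lastOf-++ 0 (map raise p) 2 []))

  children-¬startsWith2 : filter ¬startsWith2? (children W) ≡ later
  children-¬startsWith2 = begin
    filter ¬startsWith2? (map prepend2 W ++ later)          ≡⟨ filter-++ ¬startsWith2? (map prepend2 W) later ⟩
    filter ¬startsWith2? (map prepend2 W) ++ filter ¬startsWith2? later
      ≡⟨ cong₂ _++_ (filter-none ¬startsWith2? (AllP.map⁺ (All.tabulate {xs = W} λ _ ¬2 → ¬2 refl)))
                    (filter-all ¬startsWith2? (All.tabulate later-¬startsWith2)) ⟩
    later                                                   ∎
    where open ≡-Reasoning

admissibleWords-unique : ∀ k → Unique (admissibleWords k)
admissibleWords-unique zero    = [] ∷ []
admissibleWords-unique (suc k) = children-unique (s≤s (s≤s z≤n)) (admissibleWords-sound k) (admissibleWords-unique k)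

admissibleWords-length : ∀ k → length (admissibleWords k) ≡ F (suc (k + k))
                             × length (filter ¬startsWith2? (admissibleWords k)) ≡ F (k + k)
admissibleWords-length zero    = refl , refl
admissibleWords-length (suc k) with admissibleWords-length k
... | g≡ , h≡ rewrite +-suc k k = total , not-starting-2
  where
  W : List (List ℕ)
  W = admissibleWords k
  g h : ℕ
  g = length W
  h = length (filter ¬startsWith2? W)
  not-starting-2 : length (filter ¬startsWith2? (children W)) ≡ F (suc (suc (k + k)))
  not-starting-2 = begin
    length (filter ¬startsWith2? (children W))
      ≡⟨ cong length (children-¬startsWith2 (s≤s (s≤s z≤n)) (admissibleWords-sound k)) ⟩
    length (map append2 W ++ map insertBefore3 (filter ¬startsWith2? W))
      ≡⟨ length-++ (map append2 W) ⟩
    length (map append2 W) + length (map insertBefore3 (filter ¬startsWith2? W))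
      ≡⟨ cong₂ _+_ (length-map append2 W) (length-map insertBefore3 (filter ¬startsWith2? W)) ⟩
    g + h
      ≡⟨ cong₂ _+_ g≡ h≡ ⟩
    F (suc (suc (k + k)))  ∎
    where open ≡-Reasoning
  total : length (children W) ≡ F (suc (suc (suc (k + k))))
  total = begin
    length (children W)
      ≡⟨ length-++ (map prepend2 W) ⟩
    length (map prepend2 W) + length (map append2 W ++ map insertBefore3 (filter ¬startsWith2? W))
      ≡⟨ cong₂ _+_ (length-map prepend2 W)
                   (trans (length-++ (map append2 W))
                          (cong₂ _+_ (length-map append2 W) (length-map insertBefore3 (filter ¬startsWith2? W)))) ⟩
    g + (g + h)
      ≡⟨ +-comm g (g + h) ⟩
    (g + h) + g
      ≡⟨ cong₂ _+_ (cong₂ _+_ g≡ h≡) g≡ ⟩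
    F (suc (suc (suc (k + k))))  ∎
    where open ≡-Reasoning

insertBefore3-length : ∀ p → 2 ∈ p → length (insertBefore3 p) ≡ suc (length p)
insertBefore3-length (x ∷ p) 2∈ with x ≟ 2
... | yes _  = cong (suc ∘ suc) (length-map raise p)
... | no x≢2 with 2∈
...   | here 2≡x  = ⊥-elim (x≢2 (sym 2≡x))
...   | there 2∈p = cong suc (insertBefore3-length p 2∈p)

child-length : ∀ {p t} → 2 ∈ p → Child p t → length t ≡ suc (length p)
child-length {p} _  front      = cong suc (length-map raise p)
child-length {p} _  back       = trans (length-++ (map raise p)) (trans (+-comm _ 1) (cong suc (length-map raise p)))
child-length {p} 2∈ (middle _) = insertBefore3-length p 2∈

admissibleWords-word-length : ∀ k {t} → t ∈ admissibleWords k → length t ≡ suc k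
admissibleWords-word-length zero    (here refl) = refl
admissibleWords-word-length (suc k) m with ∈-children⁻ m
... | p , p∈W , child = trans (child-length 2∈p child) (cong suc (admissibleWords-word-length k p∈W))
  where
  2∈p : 2 ∈ p
  2∈p = Arrangement.complete (Admissible.arranged (admissibleWords-sound k p∈W)) ≤-refl (s≤s (s≤s z≤n))

arrangement-reverse : ∀ {n t} → Arrangement n t → Arrangement n (reverse t)
arrangement-reverse (arrangement u bd cv) =
  arrangement (Unique-reverse u) (bd ∘ AnyP.reverse⁻) (λ 2≤x x≤n → AnyP.reverse⁺ (cv 2≤x x≤n))

has213-reverse : ∀ {t} → Has213 (reverse t) → Has312 t
has213-reverse {t} (has213 occ b<a a<c) = has312 (subst (_ ⊆_) (reverse-involutive t) (reverse⁺ occ)) b<a a<c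

has312-reverse : ∀ {t} → Has312 t → Has213 (reverse t)
has312-reverse (has312 occ b<c c<a) = has213 (reverse⁺ occ) b<c c<a

chain-reverse : ∀ {t} → Chain4321 (arcs t) → Chain4321 (arcs (reverse t))
chain-reverse {t} (chain m₁ m₂ m₃ m₄ l₁₂ l₂₃ l₃₄) =
  chain (flip m₄) (flip m₃) (flip m₂) (flip m₁) (Product.swap l₃₄) (Product.swap l₂₃) (Product.swap l₁₂)
  where
  closed-reverse : reverse (1 ∷ t ++ 1 ∷ []) ≡ 1 ∷ reverse t ++ 1 ∷ []
  closed-reverse = trans (unfold-reverse 1 (t ++ 1 ∷ [])) (cong (_++ 1 ∷ []) (reverse-++ t (1 ∷ [])))
  flip : ∀ {x y} → (x , y) ∈ arcs t → (y , x) ∈ arcs (reverse t)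
  flip m = subst (λ w → (_ , _) ∈ adjacent w) closed-reverse (adjacent-reverse _ m)

-- From a cycle form to the one-line notation and back

-- The k-th letter of c, and 1 from position length c on.
entry : List ℕ → ℕ → ℕ
entry []      _       = 1
entry (x ∷ _) zero    = x
entry (_ ∷ c) (suc k) = entry c k

entry∈ : ∀ c {k} → k < length c → entry c k ∈ c
entry∈ (x ∷ c) {zero}  _        = here refl
entry∈ (x ∷ c) {suc k} (s≤s k<) = there (entry∈ c k<)

entry-index : ∀ {c x} → x ∈ c → ∃ λ k → k < length c × entry c k ≡ x
entry-index (here refl) = zero , s≤s z≤n , refl
entry-index (there m)   = let k , k< , e = entry-index m in suc k , s≤s k< , e

entry-length : ∀ c → entry c (length c) ≡ 1
entry-length []      = refl
entry-length (x ∷ c) = entry-length c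

applyUpTo-entry : ∀ c → applyUpTo (entry c) (length c) ≡ c
applyUpTo-entry []      = refl
applyUpTo-entry (x ∷ c) = cong (x ∷_) (applyUpTo-entry c)

adjacent-entry : ∀ c {k} → k < length c → (entry c k , entry c (suc k)) ∈ adjacent (c ++ 1 ∷ [])
adjacent-entry (x ∷ [])    {zero}  _        = here refl
adjacent-entry (x ∷ y ∷ c) {zero}  _        = here refl
adjacent-entry (x ∷ y ∷ c) {suc k} (s≤s k<) = there (adjacent-entry (y ∷ c) k<)
adjacent-entry (x ∷ [])    {suc k} (s≤s ())

-- The letter after x in c, and 1 after the last letter.
next : List ℕ → ℕ → ℕ
next []      x = 1
next (a ∷ c) x with a ≟ x
... | yes _ = entry c 0
... | no _  = next c x

next-adjacent : ∀ c {x} → x ∈ c → (x , next c x) ∈ adjacent (c ++ 1 ∷ [])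
next-adjacent (a ∷ c)     {x} m           with a ≟ x
next-adjacent (a ∷ [])        _           | yes refl = here refl
next-adjacent (a ∷ b ∷ c)     _           | yes refl = here refl
next-adjacent (a ∷ c)         (here refl) | no a≢a   = ⊥-elim (a≢a refl)
next-adjacent (a ∷ b ∷ c)     (there m)   | no _     = there (next-adjacent (b ∷ c) m)

next-entry : ∀ c {k} → Unique c → k < length c → next c (entry c k) ≡ entry c (suc k)
next-entry c u k< = adjacent-functional c u (next-adjacent c (entry∈ c k<)) (adjacent-entry c k<)

range : ℕ → ℕ → List ℕ
range a zero    = []
range a (suc k) = a ∷ range (suc a) k

∈-range⁻ : ∀ a k {x} → x ∈ range a k → a ≤ x × x < a + k
∈-range⁻ a (suc k) (here refl) = ≤-refl , subst (a <_) (sym (+-suc a k)) (s≤s (m≤m+n a k))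
∈-range⁻ a (suc k) {x} (there m) = let a<x , x<a+k = ∈-range⁻ (suc a) k m in <⇒≤ a<x , subst (x <_) (sym (+-suc a k)) x<a+k

range-⊆⇒< : ∀ a k {x y r} → x ∷ y ∷ r ⊆ range a k → x < y
range-⊆⇒< a (suc k) (_ ∷ʳ occ)   = range-⊆⇒< (suc a) k occ
range-⊆⇒< a (suc k) (refl ∷ occ) = proj₁ (∈-range⁻ (suc a) k (∷⊆⇒∈ occ))

Ascending : ℕ → List ℕ → Set
Ascending a []      = ⊤
Ascending a (x ∷ r) = a ≤ x × Ascending (suc x) r

ascending-⊆-range : ∀ a k xs → Ascending a xs → All (_< a + k) xs → xs ⊆ range a k
ascending-⊆-range a zero    []       _          _            = []
ascending-⊆-range a zero    (x ∷ xs) (a≤x , _)  (x<a+0 ∷ _)  = ⊥-elim (<⇒≱ (subst (x <_) (+-identityʳ a) x<a+0) a≤x)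
ascending-⊆-range a (suc k) []       _          _            = minimum _
ascending-⊆-range a (suc k) (x ∷ xs) (a≤x , asc) bounded with x ≟ a
... | yes refl = refl ∷ ascending-⊆-range (suc a) k xs asc (All.map (λ {y} → subst (y <_) (+-suc a k)) (All.tail bounded))
... | no x≢a   = a ∷ʳ ascending-⊆-range (suc a) k (x ∷ xs) (≤∧≢⇒< a≤x (x≢a ∘ sym) , asc)
                                                  (All.map (λ {y} → subst (y <_) (+-suc a k)) bounded)

tabulate-range : ∀ {k} (g : Fin k → ℕ) (f : ℕ → ℕ) a → (∀ i → g i ≡ f (a + toℕ i)) →
                 List.tabulate g ≡ map f (range a k)
tabulate-range {zero}  g f a g≗f = refl
tabulate-range {suc k} g f a g≗f = cong₂ _∷_ (trans (g≗f Fin.zero) (cong f (+-identityʳ a)))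
  (tabulate-range (g ∘ Fin.suc) f (suc a) λ i → trans (g≗f (Fin.suc i)) (cong f (+-suc a (toℕ i))))

toFin : ∀ {m} → ℕ → Fin (suc m)
toFin {m} x = x mod suc m

toℕ-toFin : ∀ {m x} → x ≤ m → toℕ (toFin {m} x) ≡ x
toℕ-toFin {m} {x} x≤m = trans (toℕ-fromℕ< (m%n<n x (suc m))) (m<n⇒m%n≡m (s≤s x≤m))

toFin-toℕ : ∀ {m} (i : Fin (suc m)) → toFin (toℕ i) ≡ i
toFin-toℕ i = toℕ-injective (toℕ-toFin (≤-pred (toℕ<n i)))

fromCycle : ∀ {m} → List ℕ → OneLine (suc m)
fromCycle c = Vec.tabulate λ i → toFin (pred (next c (suc (toℕ i))))

iter-+ : ∀ {n} (π : OneLine n) a b x → iter π (a + b) x ≡ iter π a (iter π b x)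
iter-+ π zero    b x = refl
iter-+ π (suc a) b x = cong (Vec.lookup π) (iter-+ π a b x)

cycleForm-applyUpTo : ∀ {m} (π : OneLine (suc m)) → cycleForm π ≡ applyUpTo (λ k → suc (toℕ (iter π k Fin.zero))) (suc m)
cycleForm-applyUpTo {m} π = map-upTo _ (suc m)

module FromCycle {m : ℕ} (t : List ℕ) (arr : Arrangement (suc m) t) (len : length t ≡ m) where
  open Arrangement arr

  c : List ℕ
  c = 1 ∷ t

  π : OneLine (suc m)
  π = fromCycle c

  c-length : length c ≡ suc m
  c-length = cong suc len

  t1-unique : Unique (t ++ 1 ∷ [])
  t1-unique = Unique.++⁺ unique ([] ∷ []) λ { (1∈t , here refl) → 1∉ 1∈t }

  c-bounded : ∀ {x} → x ∈ c → 1 ≤ x × x ≤ suc m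
  c-bounded (here refl) = s≤s z≤n , s≤s z≤n
  c-bounded (there x∈t) = let 2≤x , x≤n = bounded x∈t in ≤-trans (n≤1+n 1) 2≤x , x≤n

  c-complete : ∀ {x} → 1 ≤ x → x ≤ suc m → x ∈ c
  c-complete {1}           _ _   = here refl
  c-complete {suc (suc x)} _ x≤n = there (complete (s≤s (s≤s z≤n)) x≤n)

  next∈c : ∀ {x} → x ∈ c → next c x ∈ c
  next∈c x∈c with ∈-++⁻ t (adjacent-target∈ 1 (t ++ 1 ∷ []) (next-adjacent c x∈c))
  ... | inj₁ y∈t         = there y∈t
  ... | inj₂ (here y≡1)  = here y≡1

  index∈c : (i : Fin (suc m)) → suc (toℕ i) ∈ c
  index∈c i = c-complete (s≤s z≤n) (toℕ<n i)

  lookup-π : ∀ i → suc (toℕ (Vec.lookup π i)) ≡ next c (suc (toℕ i))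
  lookup-π i = begin
    suc (toℕ (Vec.lookup π i))  ≡⟨ cong (suc ∘ toℕ) (lookup∘tabulate (λ j → toFin (pred (next c (suc (toℕ j))))) i) ⟩
    suc (toℕ (toFin (pred y)))  ≡⟨ cong suc (toℕ-toFin (pred-mono-≤ y≤n)) ⟩
    suc (pred y)                ≡⟨ suc-pred y {{>-nonZero y≥1}} ⟩
    y                           ∎
    where
    open ≡-Reasoning
    y : ℕ
    y = next c (suc (toℕ i))
    y≥1 : 1 ≤ y
    y≥1 = proj₁ (c-bounded (next∈c (index∈c i)))
    y≤n : y ≤ suc m
    y≤n = proj₂ (c-bounded (next∈c (index∈c i)))

  π-arc : ∀ i → (suc (toℕ i) , suc (toℕ (Vec.lookup π i))) ∈ arcs t
  π-arc i = subst (λ y → (_ , y) ∈ arcs t) (sym (lookup-π i)) (next-adjacent c (index∈c i))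

  π-perm : IsPerm π
  π-perm i j πi≡πj = toℕ-injective (suc-injective
    (adjacent-injective 1 (t ++ 1 ∷ []) t1-unique (π-arc i)
                        (subst (λ y → (_ , suc (toℕ y)) ∈ arcs t) (sym πi≡πj) (π-arc j))))

  iter-π : ∀ k → k ≤ suc m → suc (toℕ (iter π k Fin.zero)) ≡ entry c k
  iter-π zero    _   = refl
  iter-π (suc k) k<n = begin
    suc (toℕ (Vec.lookup π (iter π k Fin.zero)))  ≡⟨ lookup-π (iter π k Fin.zero) ⟩
    next c (suc (toℕ (iter π k Fin.zero)))        ≡⟨ cong (next c) (iter-π k (<⇒≤ k<n)) ⟩
    next c (entry c k)                            ≡⟨ next-entry c unique-1∷ (subst (k <_) (sym c-length) k<n) ⟩
    entry c (suc k)                               ∎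
    where open ≡-Reasoning

  cycleForm-π : cycleForm π ≡ c
  cycleForm-π = begin
    cycleForm π                                                ≡⟨ cycleForm-applyUpTo π ⟩
    applyUpTo (λ k → suc (toℕ (iter π k Fin.zero))) (suc m)   ≡⟨ applyUpTo-cong (suc m) (λ k<n → iter-π _ (<⇒≤ k<n)) ⟩
    applyUpTo (entry c) (suc m)                                ≡⟨ cong (applyUpTo (entry c)) (sym c-length) ⟩
    applyUpTo (entry c) (length c)                             ≡⟨ applyUpTo-entry c ⟩
    c                                                          ∎
    where open ≡-Reasoning

  orbit-index : ∀ y → ∃ λ k → k < suc m × iter π k Fin.zero ≡ y
  orbit-index y with entry-index (index∈c y)
  ... | k , k<|c| , entry≡ = k , k<n , toℕ-injective (suc-injective (trans (iter-π k (<⇒≤ k<n)) entry≡))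
    where
    k<n : k < suc m
    k<n = subst (k <_) c-length k<|c|

  returns : iter π (suc m) Fin.zero ≡ Fin.zero
  returns = toℕ-injective (suc-injective (trans (iter-π (suc m) ≤-refl)
              (subst (λ l → entry c l ≡ 1) c-length (entry-length c))))

  π-cyclic : IsCyclic π
  π-cyclic = π-perm , reach
    where
    reach : ∀ x y → ∃ λ k → iter π k x ≡ y
    reach x y with orbit-index x | orbit-index y
    ... | a , a<n , refl | b , _ , refl = b + (suc m ∸ a) , (begin
      iter π (b + (suc m ∸ a)) (iter π a Fin.zero)  ≡⟨ sym (iter-+ π (b + (suc m ∸ a)) a Fin.zero) ⟩
      iter π ((b + (suc m ∸ a)) + a) Fin.zero
        ≡⟨ cong (λ l → iter π l Fin.zero) (trans (+-assoc b _ a) (cong (b +_) (m∸n+n≡m (<⇒≤ a<n)))) ⟩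
      iter π (b + suc m) Fin.zero                   ≡⟨ iter-+ π b (suc m) Fin.zero ⟩
      iter π b (iter π (suc m) Fin.zero)            ≡⟨ cong (iter π b) returns ⟩
      iter π b Fin.zero                             ∎)
      where open ≡-Reasoning

  oneLine-π : oneLineSeq π ≡ map (next c) (range 1 (suc m))
  oneLine-π = trans (map-tabulate (λ i → i) (λ i → suc (toℕ (Vec.lookup π i)))) (tabulate-range _ (next c) 1 lookup-π)

  arc⇒next : ∀ {x y} → (x , y) ∈ arcs t → y ≡ next c x × x ∈ c
  arc⇒next m = adjacent-functional c unique-1∷ m (next-adjacent c x∈c) , x∈c
    where x∈c = adjacent-source∈ 1 t 1 m

  has4321⇒chain : Has4321 (oneLineSeq π) → Chain4321 (arcs t)
  has4321⇒chain (has4321 {y₁} {y₂} {y₃} {y₄} occ b<a c<b d<c)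
    with ⊆-map⁻ (next c) (range 1 (suc m)) (subst (y₁ ∷ y₂ ∷ y₃ ∷ y₄ ∷ [] ⊆_) oneLine-π occ)
  ... | x₁ ∷ x₂ ∷ x₃ ∷ x₄ ∷ [] , xs⊆ , refl =
    chain (arc xs⊆) (arc (∷ˡ⁻ xs⊆)) (arc (∷ˡ⁻ (∷ˡ⁻ xs⊆))) (arc (∷ˡ⁻ (∷ˡ⁻ (∷ˡ⁻ xs⊆))))
          (range-⊆⇒< 1 (suc m) xs⊆ , b<a) (range-⊆⇒< 1 (suc m) (∷ˡ⁻ xs⊆) , c<b)
          (range-⊆⇒< 1 (suc m) (∷ˡ⁻ (∷ˡ⁻ xs⊆)) , d<c)
    where
    arc : ∀ {x r} → x ∷ r ⊆ range 1 (suc m) → (x , next c x) ∈ arcs t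
    arc occ′ = let 1≤x , x<n+1 = ∈-range⁻ 1 (suc m) (∷⊆⇒∈ occ′) in next-adjacent c (c-complete 1≤x (≤-pred x<n+1))

  chain⇒has4321 : Chain4321 (arcs t) → Has4321 (oneLineSeq π)
  chain⇒has4321 (chain {x₁ , _} {x₂ , _} {x₃ , _} {x₄ , _} m₁ m₂ m₃ m₄
                       (x₁<x₂ , y₂<y₁) (x₂<x₃ , y₃<y₂) (x₃<x₄ , y₄<y₃))
    with arc⇒next m₁ | arc⇒next m₂ | arc⇒next m₃ | arc⇒next m₄
  ... | refl , x₁∈c | refl , x₂∈c | refl , x₃∈c | refl , x₄∈c =
    has4321 (subst (map (next c) (x₁ ∷ x₂ ∷ x₃ ∷ x₄ ∷ []) ⊆_) (sym oneLine-π) (map⁺ (next c) xs⊆))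
            y₂<y₁ y₃<y₂ y₄<y₃
    where
    below : ∀ {x} → x ∈ c → x < 1 + suc m
    below x∈c = s≤s (proj₂ (c-bounded x∈c))
    xs⊆ : x₁ ∷ x₂ ∷ x₃ ∷ x₄ ∷ [] ⊆ range 1 (suc m)
    xs⊆ = ascending-⊆-range 1 (suc m) _ (proj₁ (c-bounded x₁∈c) , x₁<x₂ , x₂<x₃ , x₃<x₄ , tt)
            (below x₁∈c ∷ below x₂∈c ∷ below x₃∈c ∷ below x₄∈c ∷ [])

module CyclicPermutation {m : ℕ} (π : OneLine (suc m)) (cyclic : IsCyclic π) where

  orbit : ℕ → Fin (suc m)
  orbit k = iter π k Fin.zero

  iter-injective : ∀ k {x y} → iter π k x ≡ iter π k y → x ≡ y
  iter-injective zero    eq = eq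
  iter-injective (suc k) eq = iter-injective k (proj₁ cyclic _ _ eq)

  returns-after : ∀ i d → orbit i ≡ orbit (i + d) → orbit d ≡ Fin.zero
  returns-after i d eq = sym (iter-injective i (trans eq (iter-+ π i d Fin.zero)))

  periodic : ∀ p → orbit p ≡ Fin.zero → ∀ r q → orbit (r + q * p) ≡ orbit r
  periodic p _        r zero    = cong orbit (+-identityʳ r)
  periodic p returned r (suc q) = begin
    orbit (r + (p + q * p))          ≡⟨ cong orbit (trans (cong (r +_) (+-comm p (q * p))) (sym (+-assoc r (q * p) p))) ⟩
    orbit ((r + q * p) + p)          ≡⟨ iter-+ π (r + q * p) p Fin.zero ⟩
    iter π (r + q * p) (orbit p)     ≡⟨ cong (iter π (r + q * p)) returned ⟩
    orbit (r + q * p)                ≡⟨ periodic p returned r q ⟩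
    orbit r                          ∎
    where open ≡-Reasoning

  covered-before : ∀ p → orbit (suc p) ≡ Fin.zero → ∀ y → ∃ λ k → k < suc p × orbit k ≡ y
  covered-before p returned y with proj₂ cyclic Fin.zero y
  ... | K , orbit-K≡y = K % suc p , m%n<n K (suc p) ,
    trans (sym (periodic (suc p) returned (K % suc p) (K / suc p))) (trans (cong orbit (sym (m≡m%n+[m/n]*n K (suc p)))) orbit-K≡y)

  position : ∀ p → orbit (suc p) ≡ Fin.zero → Fin (suc m) → Fin (suc p)
  position p returned y = Fin.fromℕ< (proj₁ (proj₂ (covered-before p returned y)))

  orbit-position : ∀ p (returned : orbit (suc p) ≡ Fin.zero) y → orbit (toℕ (position p returned y)) ≡ y
  orbit-position p returned y =
    trans (cong orbit (toℕ-fromℕ< (proj₁ (proj₂ (covered-before p returned y))))) (proj₂ (proj₂ (covered-before p returned y)))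

  -- A return to 0 after p + 1 < m + 1 steps would squeeze all m + 1 points into p + 1 orbit positions.
  no-early-return : ∀ p → orbit (suc p) ≡ Fin.zero → suc p < suc m → ⊥
  no-early-return p returned p<m with pigeonhole p<m (position p returned)
  ... | i , j , i<j , same = <-irrefl (cong toℕ i≡j) i<j
    where
    i≡j : i ≡ j
    i≡j = trans (sym (orbit-position p returned i)) (trans (cong (orbit ∘ toℕ) same) (orbit-position p returned j))

  orbit-injective : ∀ {i j} → i < j → j < suc m → orbit i ≢ orbit j
  orbit-injective {i} i<j j<n eq with m≤n⇒∃[o]m+o≡n i<j
  ... | d , refl = no-early-return d (returns-after i (suc d) (trans eq (cong orbit (sym (+-suc i d)))))
                                   (≤-trans (s≤s (s≤s (m≤n+m d i))) j<n)

  returns : orbit (suc m) ≡ Fin.zero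
  returns with pigeonhole (n<1+n (suc m)) (orbit ∘ toℕ)
  ... | i , j , i<j , eq with m≤n⇒∃[o]m+o≡n i<j
  ...   | d , i+d+1≡j
    with m≤n⇒m<n∨m≡n (≤-trans (s≤s (m≤n+m d (toℕ i))) (subst (_≤ suc m) (sym i+d+1≡j) (≤-pred (toℕ<n j))))
  ...     | inj₁ d<m  = ⊥-elim (no-early-return d returned d<m)
    where
    returned : orbit (suc d) ≡ Fin.zero
    returned = returns-after (toℕ i) (suc d) (trans eq (cong orbit (trans (sym i+d+1≡j) (sym (+-suc (toℕ i) d)))))
  ...     | inj₂ d≡m  = subst (λ l → orbit l ≡ Fin.zero) d≡m
                          (returns-after (toℕ i) (suc d) (trans eq (cong orbit (trans (sym i+d+1≡j) (sym (+-suc (toℕ i) d))))))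

  label : ℕ → ℕ
  label k = suc (toℕ (orbit k))

  tail : List ℕ
  tail = applyUpTo (label ∘ suc) m

  cycleForm≡1∷tail : cycleForm π ≡ 1 ∷ tail
  cycleForm≡1∷tail = cycleForm-applyUpTo π

  labels-unique : Unique (1 ∷ tail)
  labels-unique = Unique.applyUpTo⁺₁ label (suc m) λ i<j j<n eq → orbit-injective i<j j<n (toℕ-injective (suc-injective eq))

  tail-length : length tail ≡ m
  tail-length = length-applyUpTo (label ∘ suc) m

  tail-arrangement : Arrangement (suc m) tail
  tail-arrangement = arrangement (Unique-∷⁻′ labels-unique) bounded complete
    where
    Unique-∷⁻′ : Unique (1 ∷ tail) → Unique tail
    Unique-∷⁻′ (_ ∷ u) = u
    bounded : ∀ {x} → x ∈ tail → 2 ≤ x × x ≤ suc m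
    bounded x∈tail with ∈-applyUpTo⁻ (label ∘ suc) x∈tail
    ... | k , _ , refl =
      ≤∧≢⇒< (s≤s z≤n) (λ 1≡x → Unique.Unique[x∷xs]⇒x∉xs labels-unique (subst (_∈ tail) (sym 1≡x) x∈tail)) ,
      toℕ<n (orbit (suc k))
    complete : ∀ {x} → 2 ≤ x → x ≤ suc m → x ∈ tail
    complete {suc x} (s≤s 1≤x) x≤m with covered-before m returns (toFin {m} x)
    ... | k , k<n , orbit-k≡x
      with subst (_∈ 1 ∷ tail) (cong suc (trans (cong toℕ orbit-k≡x) (toℕ-toFin (≤-pred x≤m)))) (∈-applyUpTo⁺ label k<n)
    ...   | here x+1≡1  = ⊥-elim (<-irrefl (sym x+1≡1) (s≤s 1≤x))
    ...   | there x∈tail = x∈tail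

  next-label : ∀ {k} → k < suc m → next (1 ∷ tail) (label k) ≡ label (suc k)
  next-label {k} k<n = adjacent-functional (1 ∷ tail) labels-unique
    (next-adjacent (1 ∷ tail) (∈-applyUpTo⁺ label k<n))
    (subst (λ w → (label k , label (suc k)) ∈ adjacent w) (sym closed) (adjacent-applyUpTo label (suc m) k<n))
    where
    closed : (1 ∷ tail) ++ 1 ∷ [] ≡ applyUpTo label (suc (suc m))
    closed = trans (cong (λ y → applyUpTo label (suc m) ++ y ∷ []) (sym (cong (suc ∘ toℕ) returns)))
                   (applyUpTo-∷ʳ label (suc m))

  fromCycle-tail : fromCycle (1 ∷ tail) ≡ π
  fromCycle-tail = trans (tabulate-cong entries) (tabulate∘lookup π)
    where
    entries : ∀ i → toFin (pred (next (1 ∷ tail) (suc (toℕ i)))) ≡ Vec.lookup π i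
    entries i with covered-before m returns i
    ... | k , k<n , refl = trans (cong (toFin ∘ pred) (next-label k<n)) (toFin-toℕ (orbit (suc k)))

-- Counting cyclic permutations by their cycle tails

has213-drop1 : ∀ {n t} → Arrangement n t → Has213 (1 ∷ t) → Has213 t
has213-drop1 _   (has213 (_ ∷ʳ occ) b<a a<c)        = has213 occ b<a a<c
has213-drop1 arr (has213 (refl ∷ occ) (s≤s z≤n) _) = case Arrangement.bounded arr (∷⊆⇒∈ occ) of λ { (() , _) }

has312-drop1 : ∀ {n t} → Arrangement n t → Has312 (1 ∷ t) → Has312 t
has312-drop1 _   (has312 (_ ∷ʳ occ) b<c c<a)        = has312 occ b<c c<a
has312-drop1 arr (has312 (refl ∷ occ) _ (s≤s z≤n)) = case Arrangement.bounded arr (∷⊆⇒∈ (∷ˡ⁻ occ)) of λ { (() , _) }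

contains213⇔ : ∀ {n t} → Arrangement n t → Contains (1 ∷ t) p213 ⇔ Has213 t
contains213⇔ arr = mk⇔ (has213-drop1 arr ∘ contains⇒has213 (Arrangement.unique-1∷ arr))
                        (has213⇒contains ∘ Has213-resp-⊆ (1 ∷ʳ ⊆-refl))

contains312⇔ : ∀ {n t} → Arrangement n t → Contains (1 ∷ t) p312 ⇔ Has312 t
contains312⇔ arr = mk⇔ (has312-drop1 arr ∘ contains⇒has312 (Arrangement.unique-1∷ arr))
                        (has312⇒contains ∘ λ { (has312 occ b<c c<a) → has312 (1 ∷ʳ occ) b<c c<a })

-- The cycle tails t (standard cycle form 1 t) of the permutations counted by a_{m+1}(4321; ρ).
CycleTail : List ℕ → ℕ → List ℕ → Set
CycleTail ρ m t = length t ≡ m × Arrangement (suc m) t × ¬ Contains (1 ∷ t) ρ × ¬ Chain4321 (arcs t)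

aEq-from-tails : ∀ m ρ (Ts : List (List ℕ)) → Unique Ts → (∀ t → t ∈ Ts ⇔ CycleTail ρ m t) →
  aEq (suc m) p4321 ρ (length Ts)
aEq-from-tails m ρ Ts u tails = map encode Ts , encodings-unique , length-map encode Ts , λ π → mk⇔ (sound π) (complete π)
  where
  encode : List ℕ → OneLine (suc m)
  encode t = fromCycle (1 ∷ t)

  decodes : ∀ {t} → t ∈ Ts → cycleForm (encode t) ≡ 1 ∷ t
  decodes {t} t∈Ts = let len , arr , _ = Equivalence.to (tails t) t∈Ts in FromCycle.cycleForm-π t arr len

  encodings-unique : Unique (map encode Ts)
  encodings-unique = Unique.map⁻ {f = cycleForm} (subst Unique (sym (trans (sym (map-∘ Ts)) (map-cong-local (All.tabulate decodes))))
                                                (Unique.map⁺ (λ { refl → refl }) u))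

  sound : ∀ π → π ∈ map encode Ts → InA (suc m) p4321 ρ π
  sound π π∈ with ∈-map⁻ encode π∈
  ... | t , t∈Ts , refl with Equivalence.to (tails t) t∈Ts
  ...   | len , arr , no-ρ , no-chain =
    π-cyclic , no-chain ∘ has4321⇒chain ∘ contains⇒has4321 , no-ρ ∘ subst (λ w → Contains w ρ) cycleForm-π
    where open FromCycle t arr len

  complete : ∀ π → InA (suc m) p4321 ρ π → π ∈ map encode Ts
  complete π (cyclic , no4321 , no-ρ) = subst (_∈ map encode Ts) fromCycle-tail (∈-map⁺ encode (Equivalence.from (tails tail)
    (tail-length , tail-arrangement , no-ρ ∘ subst (λ w → Contains w ρ) (sym cycleForm≡1∷tail) , no-chain)))
    where
    open CyclicPermutation π cyclic
    no-chain : ¬ Chain4321 (arcs tail)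
    no-chain = no4321 ∘ subst (λ σ → Contains (oneLineSeq σ) p4321) fromCycle-tail ∘ has4321⇒contains
                      ∘ FromCycle.chain⇒has4321 tail tail-arrangement tail-length

admissibleWords-tails213 : ∀ k t → t ∈ admissibleWords k ⇔ CycleTail p213 (suc k) t
admissibleWords-tails213 k t = mk⇔
  (λ t∈ → let admissible arr no213 no-chain = admissibleWords-sound k t∈ in
          admissibleWords-word-length k t∈ , arr , no213 ∘ Equivalence.to (contains213⇔ arr) , no-chain)
  (λ (_ , arr , no213 , no-chain) →
     admissibleWords-complete k (admissible arr (no213 ∘ Equivalence.from (contains213⇔ arr)) no-chain))

admissibleWords-tails312 : ∀ k t → t ∈ map reverse (admissibleWords k) ⇔ CycleTail p312 (suc k) t
admissibleWords-tails312 k t = mk⇔ to from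
  where
  to : t ∈ map reverse (admissibleWords k) → CycleTail p312 (suc k) t
  to t∈ with ∈-map⁻ reverse t∈
  ... | w , w∈ , refl with admissibleWords-sound k w∈
  ...   | admissible arr no213 no-chain =
    trans (length-reverse w) (admissibleWords-word-length k w∈) ,
    arrangement-reverse arr ,
    no213 ∘ subst Has213 (reverse-involutive w) ∘ has312-reverse ∘ Equivalence.to (contains312⇔ (arrangement-reverse arr)) ,
    no-chain ∘ subst (Chain4321 ∘ arcs) (reverse-involutive w) ∘ chain-reverse
  from : CycleTail p312 (suc k) t → t ∈ map reverse (admissibleWords k)
  from (_ , arr , no312 , no-chain) = subst (_∈ map reverse (admissibleWords k)) (reverse-involutive t)
    (∈-map⁺ reverse (admissibleWords-complete k (admissible (arrangement-reverse arr)
      (no312 ∘ Equivalence.from (contains312⇔ arr) ∘ has213-reverse)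
      (no-chain ∘ subst (Chain4321 ∘ arcs) (reverse-involutive t) ∘ chain-reverse))))

2[k+2]∸3 : ∀ k → 2 * suc (suc k) ∸ 3 ≡ suc (k + k)
2[k+2]∸3 k = cong (λ j → suc (suc j) ∸ 3) (trans (+-suc k _) (cong suc (trans (+-suc k _) (cong (suc ∘ (k +_)) (+-identityʳ k)))))

corollary3p6 : (n : ℕ) → 2 ≤ n →
    aEq n p4321 p213 (F (2 * n ∸ 3)) × aEq n p4321 p312 (F (2 * n ∸ 3))
corollary3p6 (suc zero)    (s≤s ())
corollary3p6 (suc (suc k)) _ = subst (λ N → aEq (2 + k) p4321 p213 N × aEq (2 + k) p4321 p312 N) count
  ( aEq-from-tails (suc k) p213 (admissibleWords k) (admissibleWords-unique k) (admissibleWords-tails213 k)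
  , subst (aEq (2 + k) p4321 p312) (length-map reverse (admissibleWords k))
      (aEq-from-tails (suc k) p312 (map reverse (admissibleWords k))
        (Unique.map⁺ (reverse-injective) (admissibleWords-unique k)) (admissibleWords-tails312 k)))
  where
  count : length (admissibleWords k) ≡ F (2 * suc (suc k) ∸ 3)
  count = trans (proj₁ (admissibleWords-length k)) (cong F (sym (2[k+2]∸3 k)))
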